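{- The data $(!,\eta,\mu,\alpha,\beta,\gamma)$ form a pseudomonad on the $2$-category $\mathbf{Gpd}$. Here: - $!:\mathbf{Gpd}\to\mathbf{Gpd}$ is the $2$-functor $\mathrm{Fam}$; - $\eta:\mathrm{Id}\Rightarrow!$ and $\mu:!!\Rightarrow!$ are the (strict $2$-)natural transformations defined below; - $\alpha,\beta,\gamma$ are the invertible modifications with the following components. - $(\alpha_A)_{(a_j)_{j\in J}}:(a_j)_{j\in J}\to\mu_A\eta_{!A}((a_j)_{j\in J})=(a_j)_{\langle0,j\rangle}$ is $(j\mapsto\langle0,j\rangle,(\mathrm{id}_{a_j})_j)$. - $(\beta_A)_{(a_j)_{j\in J}}:(a_j)_{j\in J}\to\mu_A(!\eta_A)((a_j)_{j\in J})=(a_j)_{\langle j,0\rangle}$ is $(j\mapsto\langle j,0\rangle,(\mathrm{id}_{a_j})_j)$. - $(\gamma_A)_x:\mu_A\mu_{!A}(x)\to\mu_A(!\mu_A)(x)$, for $x=(((a_{i,j,k})_{k\in K_{i,j}})_{j\in J_i})_{i\in I}$, is the morphism from $(a_{i,j,k})_{\langle\langle i,j\rangle,k\rangle}$ to $(a_{i,j,k})_{\langle i,\langle j,k\rangle\rangle}$ given by the bijection $\langle\langle i,j\rangle,k\rangle\mapsto\langle i,\langle j,k\rangle\rangle$ and identity components.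
   Context: $\mathbf{Gpd}$ is the $2$-category of small groupoids, functors and natural transformations. The groupoid $\mathrm{Fam}(A)$, for a groupoid $A$, has: - objects: families $(a_i)_{i\in I}$ with $I$ a finite subset of $\mathbb{N}$ and each $a_i$ an object of $A$; - morphisms $(a_i)_{i\in I}\to(b_j)_{j\in J}$: pairs $(\pi,(f_i)_{i\in I})$ with $\pi:I\to J$ a bijection and $f_i\in A(a_i,b_{\pi(i)})$; - composition: composition of bijections together with componentwise composition. $\mathrm{Fam}$ is a $2$-functor $!$: - on a functor $F$, $(a_i)\mapsto(Fa_i)$ and $(\pi,(f_i))\mapsto(\pi,(Ff_i))$; - on a natural transformation $\alpha:F\Rightarrow G$, $(!\alpha)_{(a_i)_{i\in I}}=(\mathrm{id}_I,(\alpha_{a_i})_{i\in I})$. The unit $\eta_A:A\to!A$ sends $a\mapsto(a)_{i\in\{0\}}$. For the multiplication, fix an injective function $\langle-,-\rangle:\mathbb{N}^2\to\mathbb{N}$. Then $\mu_A:!!A\to!A$ sends $((a_{i,j})_{j\in J_i})_{i\in I}$ to $(a_{i,j})_{\langle i,j\rangle\in\Sigma_{i\in I}J_i}$, where $\Sigma_{i\in I}J_i=\{\langle i,j\rangle\mid i\in I,j\in J_i\}$. On morphisms it acts by the evident induced bijection and components. -}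

module Defs where

open import Data.Nat using (ℕ; zero; suc; _+_; _∸_; _<ᵇ_)
open import Data.Bool using (if_then_else_)
open import Data.Product using (Σ; Σ-syntax; ∃₂; _×_; _,_; proj₁; proj₂)
open import Data.List using (List; []; _∷_; map; foldr; concatMap)
open import Relation.Binary.PropositionalEquality
  using (_≡_; refl; sym; trans; cong; subst; subst₂)
open import Relation.Binary.Structures using (IsEquivalence)

record RawGroupoid : Set₁ where
  infixr 9 _∘_
  infix 4 _≈_
  field
    Obj : Set
    Hom : Obj → Obj → Set
    _≈_ : ∀ {a b} → Hom a b → Hom a b → Set
    id  : ∀ {a} → Hom a a
    _∘_ : ∀ {a b c} → Hom b c → Hom a b → Hom a c

open RawGroupoid

record IsGroupoid (G : RawGroupoid) : Set where
  private module G = RawGroupoid G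
  field
    ≈-equiv    : ∀ {a b} → IsEquivalence (G._≈_ {a} {b})
    ∘-resp-≈   : ∀ {a b c} {f f' : G.Hom a b} {g g' : G.Hom b c} →
                 g G.≈ g' → f G.≈ f' → (g G.∘ f) G.≈ (g' G.∘ f')
    assoc      : ∀ {a b c d} (f : G.Hom a b) (g : G.Hom b c) (h : G.Hom c d) →
                 ((h G.∘ g) G.∘ f) G.≈ (h G.∘ (g G.∘ f))
    identityˡ  : ∀ {a b} (f : G.Hom a b) → (G.id G.∘ f) G.≈ f
    identityʳ  : ∀ {a b} (f : G.Hom a b) → (f G.∘ G.id) G.≈ f
    invertible : ∀ {a b} (f : G.Hom a b) →
                 Σ[ g ∈ G.Hom b a ] ((g G.∘ f) G.≈ G.id × (f G.∘ g) G.≈ G.id)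

record Groupoid : Set₁ where
  field
    raw        : RawGroupoid
    isGroupoid : IsGroupoid raw

∣_∣ : Groupoid → RawGroupoid
∣ A ∣ = Groupoid.raw A

record HEq (G : RawGroupoid) {a b a' b' : Obj G} (f : Hom G a b) (g : Hom G a' b') : Set where
  field
    src : a ≡ a'
    tgt : b ≡ b'
    eq  : _≈_ G (subst₂ (Hom G) src tgt f) g

compAlong : (G : RawGroupoid) {a b b' c : Obj G} →
            Hom G b' c → b ≡ b' → Hom G a b → Hom G a c
compAlong G {a = a} g e f = _∘_ G g (subst (Hom G a) e f)

record RawFunctor (A B : RawGroupoid) : Set where
  field
    F₀ : Obj A → Obj B
    F₁ : ∀ {a b} → Hom A a b → Hom B (F₀ a) (F₀ b)

open RawFunctor

record IsFunctor {A B : RawGroupoid} (F : RawFunctor A B) : Set where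
  field
    F-resp : ∀ {a b} {f g : Hom A a b} → _≈_ A f g → _≈_ B (F₁ F f) (F₁ F g)
    F-id   : ∀ {a} → _≈_ B (F₁ F (id A {a})) (id B)
    F-∘    : ∀ {a b c} (f : Hom A a b) (g : Hom A b c) →
             _≈_ B (F₁ F (_∘_ A g f)) (_∘_ B (F₁ F g) (F₁ F f))

record Functor (A B : Groupoid) : Set where
  field
    raw       : RawFunctor ∣ A ∣ ∣ B ∣
    isFunctor : IsFunctor raw

⌊_⌋ : ∀ {A B} → Functor A B → RawFunctor ∣ A ∣ ∣ B ∣
⌊ F ⌋ = Functor.raw F

idR : (A : RawGroupoid) → RawFunctor A A
idR A = record { F₀ = λ a → a ; F₁ = λ f → f }

infixr 9 _∘R_
_∘R_ : ∀ {A B C} → RawFunctor B C → RawFunctor A B → RawFunctor A C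
G ∘R F = record { F₀ = λ a → F₀ G (F₀ F a) ; F₁ = λ f → F₁ G (F₁ F f) }

record _≐_ {A B : RawGroupoid} (F G : RawFunctor A B) : Set where
  field
    obj : ∀ a → F₀ F a ≡ F₀ G a
    hom : ∀ {a b} (f : Hom A a b) → HEq B (F₁ F f) (F₁ G f)

NatT : ∀ {A B} → RawFunctor A B → RawFunctor A B → Set
NatT {A} {B} F G = ∀ a → Hom B (F₀ F a) (F₀ G a)

IsNatural : ∀ {A B} (F G : RawFunctor A B) → NatT F G → Set
IsNatural {A} {B} F G θ =
  ∀ {a b} (f : Hom A a b) → _≈_ B (_∘_ B (θ b) (F₁ F f)) (_∘_ B (F₁ G f) (θ a))

idN : ∀ {A B} (F : RawFunctor A B) → NatT F F
idN {B = B} F a = id B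

vcomp : ∀ {A B} {F G H : RawFunctor A B} → NatT G H → NatT F G → NatT F H
vcomp {B = B} ψ θ a = _∘_ B (ψ a) (θ a)

whiskerL : ∀ {A B C} {F G : RawFunctor A B} (H : RawFunctor B C) →
           NatT F G → NatT (H ∘R F) (H ∘R G)
whiskerL H θ a = F₁ H (θ a)

whiskerR : ∀ {A B C} {F G : RawFunctor A B} (K : RawFunctor C A) →
           NatT F G → NatT (F ∘R K) (G ∘R K)
whiskerR K θ c = θ (F₀ K c)

-- Families indexed by finite subsets of ℕ.
-- A family (a_i)_{i∈I}, I ⊆ ℕ finite, is represented canonically as the list
-- of its entries in increasing order of index, each index stored as the GAP
-- to the previous one: [(d₀,a₀),(d₁,a₁),…] has indices d₀, d₀+1+d₁, …
-- This is a bijection between lists and finite families.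

FamObj : Set → Set
FamObj X = List (ℕ × X)

data _∈ₖ_ {X : Set} : ℕ → List (ℕ × X) → Set where
  here  : ∀ {d a l} → d ∈ₖ ((d , a) ∷ l)
  there : ∀ {d a k l} → k ∈ₖ l → suc (d + k) ∈ₖ ((d , a) ∷ l)

Idx : {X : Set} → List (ℕ × X) → Set
Idx l = Σ ℕ (_∈ₖ l)

key : ∀ {X} {l : List (ℕ × X)} → Idx l → ℕ
key = proj₁

val : ∀ {X} {l : List (ℕ × X)} → Idx l → X
val (_ , here {a = a}) = a
val (_ , there m) = val (_ , m)

record FamHom (A : RawGroupoid) (x y : FamObj (Obj A)) : Set where
  field
    π     : Idx x → Idx y
    π⁻    : Idx y → Idx x
    π⁻∘π  : ∀ i → π⁻ (π i) ≡ i
    π∘π⁻  : ∀ j → π (π⁻ j) ≡ j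
    comp  : ∀ i → Hom A (val i) (val (π i))

open FamHom public

FamEq : ∀ (A : RawGroupoid) {x y} → FamHom A x y → FamHom A x y → Set
FamEq A φ ψ = ∀ i → π φ i ≡ π ψ i × HEq A (comp φ i) (comp ψ i)

famId : ∀ (A : RawGroupoid) {x} → FamHom A x x
famId A = record
  { π = λ i → i ; π⁻ = λ i → i ; π⁻∘π = λ _ → refl ; π∘π⁻ = λ _ → refl
  ; comp = λ i → id A }

famComp : ∀ (A : RawGroupoid) {x y z} → FamHom A y z → FamHom A x y → FamHom A x z
famComp A ψ φ = record
  { π = λ i → π ψ (π φ i)
  ; π⁻ = λ k → π⁻ φ (π⁻ ψ k)
  ; π⁻∘π = λ i → trans (cong (π⁻ φ) (π⁻∘π ψ (π φ i))) (π⁻∘π φ i)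
  ; π∘π⁻ = λ k → trans (cong (π ψ) (π∘π⁻ φ (π⁻ ψ k))) (π∘π⁻ ψ k)
  ; comp = λ i → _∘_ A (comp ψ (π φ i)) (comp φ i) }

-- the groupoid Fam(A) = !A (raw data; its laws are part of the theorem)
T : RawGroupoid → RawGroupoid
T A = record
  { Obj = FamObj (Obj A)
  ; Hom = FamHom A
  ; _≈_ = FamEq A
  ; id  = famId A
  ; _∘_ = famComp A }

fmapO : ∀ {X Y : Set} → (X → Y) → List (ℕ × X) → List (ℕ × Y)
fmapO f [] = []
fmapO f ((d , a) ∷ l) = (d , f a) ∷ fmapO f l

module _ {X Y : Set} (f : X → Y) where

  conv : ∀ {k} {l : List (ℕ × X)} → k ∈ₖ l → k ∈ₖ fmapO f l
  conv here = here
  conv (there m) = there (conv m)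

  back : ∀ {k} {l : List (ℕ × X)} → k ∈ₖ fmapO f l → k ∈ₖ l
  back {l = (d , a) ∷ l} here = here
  back {l = (d , a) ∷ l} (there m) = there (back m)

  back-conv : ∀ {k} {l : List (ℕ × X)} (m : k ∈ₖ l) → back (conv m) ≡ m
  back-conv here = refl
  back-conv (there m) = cong there (back-conv m)

  conv-back : ∀ {k} {l : List (ℕ × X)} (m : k ∈ₖ fmapO f l) → conv (back m) ≡ m
  conv-back {l = (d , a) ∷ l} here = refl
  conv-back {l = (d , a) ∷ l} (there m) = cong there (conv-back m)

  convI : ∀ {l : List (ℕ × X)} → Idx l → Idx (fmapO f l)
  convI (k , m) = k , conv m

  backI : ∀ {l : List (ℕ × X)} → Idx (fmapO f l) → Idx l
  backI (k , m) = k , back m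

  backI-convI : ∀ {l : List (ℕ × X)} (i : Idx l) → backI (convI i) ≡ i
  backI-convI (k , m) = cong (k ,_) (back-conv m)

  convI-backI : ∀ {l : List (ℕ × X)} (i : Idx (fmapO f l)) → convI (backI i) ≡ i
  convI-backI (k , m) = cong (k ,_) (conv-back m)

  val-conv : ∀ {l : List (ℕ × X)} (i : Idx l) → val (convI i) ≡ f (val i)
  val-conv (_ , here) = refl
  val-conv (_ , there m) = val-conv (_ , m)

  val-back : ∀ {l : List (ℕ × X)} (i : Idx (fmapO f l)) → val i ≡ f (val (backI i))
  val-back {l = (d , a) ∷ l} (_ , here) = refl
  val-back {l = (d , a) ∷ l} (_ , there m) = val-back (_ , m)

TF : ∀ {A B} → RawFunctor A B → RawFunctor (T A) (T B)
TF {A} {B} F = record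
  { F₀ = fmapO (F₀ F)
  ; F₁ = λ {x} {y} φ → record
      { π    = λ i → convI (F₀ F) (π φ (backI (F₀ F) i))
      ; π⁻   = λ j → convI (F₀ F) (π⁻ φ (backI (F₀ F) j))
      ; π⁻∘π = λ i → trans
                 (cong (λ z → convI (F₀ F) (π⁻ φ z))
                       (backI-convI (F₀ F) (π φ (backI (F₀ F) i))))
                 (trans (cong (convI (F₀ F)) (π⁻∘π φ (backI (F₀ F) i)))
                        (convI-backI (F₀ F) i))
      ; π∘π⁻ = λ j → trans
                 (cong (λ z → convI (F₀ F) (π φ z))
                       (backI-convI (F₀ F) (π⁻ φ (backI (F₀ F) j))))
                 (trans (cong (convI (F₀ F)) (π∘π⁻ φ (backI (F₀ F) j)))
                        (convI-backI (F₀ F) j))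
      ; comp = λ i → subst₂ (Hom B)
                 (sym (val-back (F₀ F) i))
                 (sym (val-conv (F₀ F) (π φ (backI (F₀ F) i))))
                 (F₁ F (comp φ (backI (F₀ F) i)))
      } }

T2 : ∀ {A B} (F G : RawFunctor A B) → NatT F G → NatT (TF F) (TF G)
T2 {A} {B} F G θ x = record
  { π    = λ i → convI (F₀ G) (backI (F₀ F) i)
  ; π⁻   = λ j → convI (F₀ F) (backI (F₀ G) j)
  ; π⁻∘π = λ i → trans (cong (convI (F₀ F)) (backI-convI (F₀ G) (backI (F₀ F) i)))
                       (convI-backI (F₀ F) i)
  ; π∘π⁻ = λ j → trans (cong (convI (F₀ G)) (backI-convI (F₀ F) (backI (F₀ G) j)))
                       (convI-backI (F₀ G) j)
  ; comp = λ i → subst₂ (Hom B)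
             (sym (val-back (F₀ F) i))
             (sym (val-conv (F₀ G) (backI (F₀ F) i)))
             (θ (val (backI (F₀ F) i)))
  }

η₀ : ∀ {X : Set} → X → FamObj X
η₀ a = (0 , a) ∷ []

ηR : (A : RawGroupoid) → RawFunctor A (T A)
ηR A = record
  { F₀ = η₀
  ; F₁ = λ {a} {b} f → record
      { π = λ _ → (0 , here)
      ; π⁻ = λ _ → (0 , here)
      ; π⁻∘π = λ { (_ , here) → refl ; (_ , there ()) }
      ; π∘π⁻ = λ { (_ , here) → refl ; (_ , there ()) }
      ; comp = λ { (_ , here) → f ; (_ , there ()) }
      } }

-- the multiplication on objects, for a fixed pairing function ⟨-,-⟩ = pair:
-- ((a_{i,j})_{j∈J_i})_{i∈I} ↦ (a_{i,j})_{⟨i,j⟩ ∈ Σ_{i∈I} J_i}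

toAbs : ∀ {X : Set} → ℕ → List (ℕ × X) → List (ℕ × X)
toAbs b [] = []
toAbs b ((d , a) ∷ l) = (b + d , a) ∷ toAbs (b + suc d) l

-- insert an entry with absolute index k into a (gap-represented) family.
-- (An already present index is never inserted in our use, since ⟨-,-⟩ is injective.)
insertF : ∀ {X : Set} → ℕ → X → List (ℕ × X) → List (ℕ × X)
insertF k a [] = (k , a) ∷ []
insertF k a ((d , b) ∷ l) =
  if k <ᵇ d then (k , a) ∷ (d ∸ suc k , b) ∷ l
            else (d , b) ∷ insertF (k ∸ suc d) a l

fromAbs : ∀ {X : Set} → List (ℕ × X) → List (ℕ × X)
fromAbs = foldr (λ p acc → insertF (proj₁ p) (proj₂ p) acc) []

μ₀ : ∀ {X : Set} → (ℕ → ℕ → ℕ) → FamObj (FamObj X) → FamObj X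
μ₀ pair x =
  fromAbs (concatMap (λ iy → map (λ ja → pair (proj₁ iy) (proj₁ ja) , proj₂ ja)
                                 (toAbs 0 (proj₂ iy)))
                     (toAbs 0 x))

TG : ((A : Groupoid) → IsGroupoid (T ∣ A ∣)) → Groupoid → Groupoid
TG fg A = record { raw = T ∣ A ∣ ; isGroupoid = fg A }

record IsPseudomonad (pair : ℕ → ℕ → ℕ)
                     (fg : (A : Groupoid) → IsGroupoid (T ∣ A ∣)) : Set₁ where
  field
    T-functor : ∀ {A B} (F : Functor A B) → IsFunctor (TF ⌊ F ⌋)
    T-id      : ∀ (A : Groupoid) → TF (idR ∣ A ∣) ≐ idR (T ∣ A ∣)
    T-comp    : ∀ {A B C} (F : Functor A B) (G : Functor B C) →
                TF (⌊ G ⌋ ∘R ⌊ F ⌋) ≐ (TF ⌊ G ⌋ ∘R TF ⌊ F ⌋)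
    T2-natural : ∀ {A B} (F G : Functor A B) (θ : NatT ⌊ F ⌋ ⌊ G ⌋) →
                 IsNatural ⌊ F ⌋ ⌊ G ⌋ θ →
                 IsNatural (TF ⌊ F ⌋) (TF ⌊ G ⌋) (T2 ⌊ F ⌋ ⌊ G ⌋ θ)
    T2-id     : ∀ {A B} (F : Functor A B) x →
                _≈_ (T ∣ B ∣) (T2 ⌊ F ⌋ ⌊ F ⌋ (idN ⌊ F ⌋) x) (id (T ∣ B ∣))
    T2-vcomp  : ∀ {A B} (F G H : Functor A B)
                (θ : NatT ⌊ F ⌋ ⌊ G ⌋) (ψ : NatT ⌊ G ⌋ ⌊ H ⌋) →
                IsNatural ⌊ F ⌋ ⌊ G ⌋ θ → IsNatural ⌊ G ⌋ ⌊ H ⌋ ψ → ∀ x →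
                _≈_ (T ∣ B ∣) (T2 ⌊ F ⌋ ⌊ H ⌋ (vcomp {A = ∣ A ∣} {B = ∣ B ∣} {F = ⌊ F ⌋} {G = ⌊ G ⌋} {H = ⌊ H ⌋} ψ θ) x)
                              (_∘_ (T ∣ B ∣) (T2 ⌊ G ⌋ ⌊ H ⌋ ψ x) (T2 ⌊ F ⌋ ⌊ G ⌋ θ x))
    T2-whiskerL : ∀ {A B C} (F G : Functor A B) (H : Functor B C)
                  (θ : NatT ⌊ F ⌋ ⌊ G ⌋) → IsNatural ⌊ F ⌋ ⌊ G ⌋ θ → ∀ x →
                  HEq (T ∣ C ∣)
                    (T2 (⌊ H ⌋ ∘R ⌊ F ⌋) (⌊ H ⌋ ∘R ⌊ G ⌋)
                        (whiskerL {F = ⌊ F ⌋} {G = ⌊ G ⌋} ⌊ H ⌋ θ) x)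
                    (F₁ (TF ⌊ H ⌋) (T2 ⌊ F ⌋ ⌊ G ⌋ θ x))
    T2-whiskerR : ∀ {A B C} (F G : Functor A B) (K : Functor C A)
                  (θ : NatT ⌊ F ⌋ ⌊ G ⌋) → IsNatural ⌊ F ⌋ ⌊ G ⌋ θ → ∀ x →
                  HEq (T ∣ B ∣)
                    (T2 (⌊ F ⌋ ∘R ⌊ K ⌋) (⌊ G ⌋ ∘R ⌊ K ⌋)
                        (whiskerR {F = ⌊ F ⌋} {G = ⌊ G ⌋} ⌊ K ⌋ θ) x)
                    (T2 ⌊ F ⌋ ⌊ G ⌋ θ (F₀ (TF ⌊ K ⌋) x))

    η-functor : ∀ (A : Groupoid) → IsFunctor (ηR ∣ A ∣)
    η-nat₁    : ∀ {A B} (F : Functor A B) → (ηR ∣ B ∣ ∘R ⌊ F ⌋) ≐ (TF ⌊ F ⌋ ∘R ηR ∣ A ∣)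
    η-nat₂    : ∀ {A B} (F G : Functor A B) (θ : NatT ⌊ F ⌋ ⌊ G ⌋) →
                IsNatural ⌊ F ⌋ ⌊ G ⌋ θ → ∀ a →
                HEq (T ∣ B ∣) (F₁ (ηR ∣ B ∣) (θ a)) (T2 ⌊ F ⌋ ⌊ G ⌋ θ (η₀ a))

    μ₁ : ∀ (A : Groupoid) {x y} → FamHom (T ∣ A ∣) x y → FamHom ∣ A ∣ (μ₀ pair x) (μ₀ pair y)

  μR : (A : Groupoid) → RawFunctor (T (T ∣ A ∣)) (T ∣ A ∣)
  μR A = record { F₀ = μ₀ pair ; F₁ = μ₁ A }

  field
    μ-spec : ∀ (A : Groupoid) {x y} (φ : FamHom (T ∣ A ∣) x y)
             (i : Idx x) (j : Idx (val i)) (m : pair (key i) (key j) ∈ₖ μ₀ pair x) →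
             key (π (μ₁ A φ) (_ , m)) ≡ pair (key (π φ i)) (key (π (comp φ i) j))
             × HEq ∣ A ∣ (comp (μ₁ A φ) (_ , m)) (comp (comp φ i) j)

    μ-functor : ∀ (A : Groupoid) → IsFunctor (μR A)
    μ-nat₁    : ∀ {A B} (F : Functor A B) →
                (μR B ∘R TF (TF ⌊ F ⌋)) ≐ (TF ⌊ F ⌋ ∘R μR A)
    μ-nat₂    : ∀ {A B} (F G : Functor A B) (θ : NatT ⌊ F ⌋ ⌊ G ⌋) →
                IsNatural ⌊ F ⌋ ⌊ G ⌋ θ → ∀ x →
                HEq (T ∣ B ∣)
                  (μ₁ B (T2 (TF ⌊ F ⌋) (TF ⌊ G ⌋) (T2 ⌊ F ⌋ ⌊ G ⌋ θ) x))
                  (T2 ⌊ F ⌋ ⌊ G ⌋ θ (μ₀ pair x))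

    α : ∀ (A : Groupoid) (x : Obj (T ∣ A ∣)) → Hom (T ∣ A ∣) x (μ₀ pair (η₀ x))
    α-spec : ∀ (A : Groupoid) x (j : Idx x) →
             key (π (α A x) j) ≡ pair 0 (key j)
             × HEq ∣ A ∣ (comp (α A x) j) (id ∣ A ∣ {val j})
    α-natural : ∀ (A : Groupoid) →
                IsNatural (idR (T ∣ A ∣)) (μR A ∘R ηR (T ∣ A ∣)) (α A)
    α-modification : ∀ {A B} (F : Functor A B) x →
                     HEq (T ∣ B ∣) (α B (F₀ (TF ⌊ F ⌋) x)) (F₁ (TF ⌊ F ⌋) (α A x))

    β : ∀ (A : Groupoid) (x : Obj (T ∣ A ∣)) →
        Hom (T ∣ A ∣) x (μ₀ pair (F₀ (TF (ηR ∣ A ∣)) x))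
    β-spec : ∀ (A : Groupoid) x (j : Idx x) →
             key (π (β A x) j) ≡ pair (key j) 0
             × HEq ∣ A ∣ (comp (β A x) j) (id ∣ A ∣ {val j})
    β-natural : ∀ (A : Groupoid) →
                IsNatural (idR (T ∣ A ∣)) (μR A ∘R TF (ηR ∣ A ∣)) (β A)
    β-modification : ∀ {A B} (F : Functor A B) x →
                     HEq (T ∣ B ∣) (β B (F₀ (TF ⌊ F ⌋) x)) (F₁ (TF ⌊ F ⌋) (β A x))

    γ : ∀ (A : Groupoid) (x : Obj (T (T (T ∣ A ∣)))) →
        Hom (T ∣ A ∣) (μ₀ pair (μ₀ pair x)) (μ₀ pair (F₀ (TF (μR A)) x))
    γ-spec : ∀ (A : Groupoid) x (i : Idx x) (j : Idx (val i)) (k : Idx (val j))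
             (m : pair (pair (key i) (key j)) (key k) ∈ₖ μ₀ pair (μ₀ pair x)) →
             key (π (γ A x) (_ , m)) ≡ pair (key i) (pair (key j) (key k))
             × HEq ∣ A ∣ (comp (γ A x) (_ , m)) (id ∣ A ∣ {val k})
    γ-natural : ∀ (A : Groupoid) →
                IsNatural (μR A ∘R μR (TG fg A)) (μR A ∘R TF (μR A)) (γ A)
    γ-modification : ∀ {A B} (F : Functor A B) x →
                     HEq (T ∣ B ∣) (γ B (F₀ (TF (TF (TF ⌊ F ⌋))) x))
                                   (F₁ (TF ⌊ F ⌋) (γ A x))

    ---------------- coherence axioms
    -- associativity:  (γ !!μ)·(γ μ!!)  =  (μ !γ)·(γ !μ!)·(μ γ!)
    pentagon : ∀ (A : Groupoid) (x : Obj (T (T (T (T ∣ A ∣))))) →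
      ∃₂ λ (e₁ : μ₀ pair (F₀ (TF (μR A)) (μ₀ pair x))
                 ≡ μ₀ pair (μ₀ pair (F₀ (TF (TF (μR A))) x)))
           (e₂ : μ₀ pair (F₀ (TF (μR A)) (F₀ (TF (μR (TG fg A))) x))
                 ≡ μ₀ pair (F₀ (TF (μR A ∘R μR (TG fg A))) x)) →
      HEq (T ∣ A ∣)
        (compAlong (T ∣ A ∣) (γ A (F₀ (TF (TF (μR A))) x)) e₁ (γ A (μ₀ pair x)))
        (compAlong (T ∣ A ∣)
           (μ₁ A (T2 (μR A ∘R μR (TG fg A)) (μR A ∘R TF (μR A)) (γ A) x))
           e₂
           (_∘_ (T ∣ A ∣) (γ A (F₀ (TF (μR (TG fg A))) x)) (μ₁ A (γ (TG fg A) x))))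
    -- unit:  (γ !η!)·(μ β!)  =  μ !α
    triangle : ∀ (A : Groupoid) (x : Obj (T (T ∣ A ∣))) →
      HEq (T ∣ A ∣)
        (_∘_ (T ∣ A ∣) (γ A (F₀ (TF (ηR (T ∣ A ∣))) x)) (μ₁ A (β (TG fg A) x)))
        (μ₁ A (T2 (idR (T ∣ A ∣)) (μR A ∘R ηR (T ∣ A ∣)) (α A) x))

{-# OPTIONS --safe #-}
-- The groupoid laws of Fam A hold componentwise, and ! acts on indices by
-- transport along fmapO, so the 2-functor laws hold index by index. The content
-- of μ is one combinatorial fact: since ⟨-,-⟩ is injective and fromAbs faithfully
-- rebuilds a family from entries with distinct absolute indices, the indices of
-- μ x correspond, via K = ⟨i , j⟩, to pairs (i , j) with i ∈ x and j ∈ x_i.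
-- An index is determined by its key, so two morphisms of families agree as soon
-- as they send each key to the same key with equal components. α, β and γ only
-- rename indices and have identity components, hence every naturality,
-- modification and coherence axiom reduces to a computation on keys; for the
-- pentagon both sides send ⟨⟨⟨a,b⟩,c⟩,d⟩ to ⟨a,⟨b,⟨c,d⟩⟩⟩.

module Submission where

open import Defs
open import Data.Nat using (ℕ; suc; _+_; _∸_; _<ᵇ_; _<_; _≤_; s≤s)
open import Data.Nat.Properties
open import Data.Bool using (true; false) renaming (T to IsTrue)
open import Data.Product using (Σ; Σ-syntax; _×_; _,_; proj₁; proj₂)
open import Data.Sum using (_⊎_; inj₁; inj₂; [_,_]′)
open import Data.List using (List; []; _∷_; map; concatMap; _++_)
open import Data.List.Membership.Propositional using (_∈_; find; lose)
open import Data.List.Membership.Propositional.Properties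
  using (∈-map⁺; ∈-map⁻; ∈-++⁻; ∈-concatMap⁺; ∈-concatMap⁻)
open import Data.List.Relation.Unary.Any using (here; there)
open import Data.Empty using (⊥; ⊥-elim)
open import Data.Unit using (⊤; tt)
open import Relation.Nullary using (¬_)
open import Relation.Binary.PropositionalEquality
open import Relation.Binary.Structures using (IsEquivalence)

open RawGroupoid
open RawFunctor

∈ₖ-irrelevant : ∀ {X} {l : List (ℕ × X)} {k k'} (m : k ∈ₖ l) (m' : k' ∈ₖ l) (e : k ≡ k') →
                subst (_∈ₖ l) e m ≡ m'
∈ₖ-irrelevant here here refl = refl
∈ₖ-irrelevant (here {d = d}) (there {k = k} _) e = ⊥-elim (<-irrefl e (s≤s (m≤m+n d k)))
∈ₖ-irrelevant (there {d = d} {k = k} _) here e = ⊥-elim (<-irrefl (sym e) (s≤s (m≤m+n d k)))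
∈ₖ-irrelevant (there {d = d} m) (there m') e with +-cancelˡ-≡ d _ _ (suc-injective e)
... | refl with e
... | refl = cong there (∈ₖ-irrelevant m m' refl)

key-injective : ∀ {X} {l : List (ℕ × X)} {i j : Idx l} → key i ≡ key j → i ≡ j
key-injective {i = k , m} {j = .k , m'} refl = cong (k ,_) (∈ₖ-irrelevant m m' refl)

IdxΣ : ∀ {X} → FamObj (FamObj X) → Set
IdxΣ x = Σ (Idx x) (λ i → Idx (val i))

keys-injective : ∀ {X} {x : FamObj (FamObj X)} {i i' : Idx x} {j : Idx (val i)} {j' : Idx (val i')} →
                 key i ≡ key i' → key j ≡ key j' → _≡_ {A = IdxΣ x} (i , j) (i' , j')
keys-injective {i = i} {i'} {j} {j'} e e' with key-injective {i = i} {i'} e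
... | refl with key-injective {i = j} {j'} e'
... | refl = refl

val-cong-key : ∀ {X} {l l' : List (ℕ × X)} (e : l ≡ l') (i : Idx l) (i' : Idx l') →
               key i ≡ key i' → val i ≡ val i'
val-cong-key refl i i' e = cong val (key-injective {i = i} {i'} e)

castIdx : ∀ {X} {l l' : List (ℕ × X)} → l ≡ l' → Idx l → Idx l'
castIdx refl i = i

key-castIdx : ∀ {X} {l l' : List (ℕ × X)} (e : l ≡ l') (i : Idx l) → key (castIdx e i) ≡ key i
key-castIdx refl i = refl

val-castIdx : ∀ {X} {l l' : List (ℕ × X)} (e : l ≡ l') (i : Idx l) → val (castIdx e i) ≡ val i
val-castIdx refl i = refl

η₀-Idx : ∀ {X} {a : X} (i : Idx (η₀ a)) → i ≡ (0 , here)
η₀-Idx (_ , here) = refl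

key-η₀ : ∀ {X} {a : X} {l : List (ℕ × X)} (e : l ≡ η₀ a) (i : Idx l) → key i ≡ 0
key-η₀ refl i = cong key (η₀-Idx i)

-- The groupoid Fam A

module HEqProperties (G : RawGroupoid) (isG : IsGroupoid G) where
  open IsGroupoid isG
  private module E {a b} = IsEquivalence (≈-equiv {a} {b})

  ≋-refl : ∀ {a b} {f : Hom G a b} → HEq G f f
  ≋-refl = record { src = refl ; tgt = refl ; eq = E.refl }

  ≈⇒≋ : ∀ {a b} {f g : Hom G a b} → _≈_ G f g → HEq G f g
  ≈⇒≋ p = record { src = refl ; tgt = refl ; eq = p }

  ≋-sym : ∀ {a b a' b'} {f : Hom G a b} {g : Hom G a' b'} → HEq G f g → HEq G g f
  ≋-sym record { src = refl ; tgt = refl ; eq = eq } = ≈⇒≋ (E.sym eq)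

  ≋-trans : ∀ {a b a' b' a'' b''} {f : Hom G a b} {g : Hom G a' b'} {h : Hom G a'' b''} →
            HEq G f g → HEq G g h → HEq G f h
  ≋-trans record { src = refl ; tgt = refl ; eq = p } record { src = refl ; tgt = refl ; eq = q } =
    ≈⇒≋ (E.trans p q)

  ∘-resp-≋ : ∀ {a b c a' b' c'} {f : Hom G a b} {f' : Hom G a' b'} {g : Hom G b c} {g' : Hom G b' c'} →
             HEq G g g' → HEq G f f' → HEq G (_∘_ G g f) (_∘_ G g' f')
  ∘-resp-≋ record { src = refl ; tgt = refl ; eq = p } record { src = refl ; tgt = refl ; eq = q } =
    ≈⇒≋ (∘-resp-≈ p q)

  subst₂-≋ : ∀ {a b a' b'} (p : a ≡ a') (q : b ≡ b') (f : Hom G a b) → HEq G (subst₂ (Hom G) p q f) f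
  subst₂-≋ refl refl f = ≋-refl

  subst-≋ : ∀ {a b b'} (q : b ≡ b') (f : Hom G a b) → HEq G (subst (Hom G a) q f) f
  subst-≋ refl f = ≋-refl

  id-≋ : ∀ {a a'} → a ≡ a' → HEq G (id G {a}) (id G {a'})
  id-≋ refl = ≋-refl

  ≋-id-unique : ∀ {a b a' b' c c'} {f : Hom G a b} {g : Hom G a' b'} →
                HEq G f (id G {c}) → HEq G g (id G {c'}) → c ≡ c' → HEq G f g
  ≋-id-unique p q e = ≋-trans p (≋-trans (id-≋ e) (≋-sym q))

  identityˡ-≋ : ∀ {a b c d} {f : Hom G a b} {g : Hom G b c} → HEq G g (id G {d}) → HEq G (_∘_ G g f) f
  identityˡ-≋ {f = f} p@(record { src = refl ; tgt = refl }) = ≋-trans (∘-resp-≋ p ≋-refl) (≈⇒≋ (identityˡ f))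

  identityʳ-≋ : ∀ {a b c d} {f : Hom G a b} {g : Hom G b c} → HEq G f (id G {d}) → HEq G (_∘_ G g f) g
  identityʳ-≋ {g = g} p@(record { src = refl ; tgt = refl }) = ≋-trans (∘-resp-≋ ≋-refl p) (≈⇒≋ (identityʳ g))

  inv : ∀ {a b} → Hom G a b → Hom G b a
  inv f = proj₁ (invertible f)

  inv-resp-≋ : ∀ {a b a' b'} {f : Hom G a b} {f' : Hom G a' b'} → HEq G f f' → HEq G (inv f) (inv f')
  inv-resp-≋ {f = f} {f'} p@(record { src = refl ; tgt = refl }) =
    ≋-trans (≋-sym (≈⇒≋ (identityʳ (inv f))))
    (≋-trans (∘-resp-≋ ≋-refl (≋-sym (≈⇒≋ (proj₂ (proj₂ (invertible f'))))))
    (≋-trans (∘-resp-≋ ≋-refl (∘-resp-≋ (≋-sym p) ≋-refl))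
    (≋-trans (≋-sym (≈⇒≋ (assoc _ _ _)))
    (≋-trans (∘-resp-≋ (≈⇒≋ (proj₁ (proj₂ (invertible f)))) ≋-refl)
             (≈⇒≋ (identityˡ _))))))

F₁-resp-≋ : ∀ {A B : RawGroupoid} (F : RawFunctor A B) → IsFunctor F →
            ∀ {a b a' b'} {f : Hom A a b} {g : Hom A a' b'} → HEq A f g → HEq B (F₁ F f) (F₁ F g)
F₁-resp-≋ F isF record { src = refl ; tgt = refl ; eq = eq } =
  record { src = refl ; tgt = refl ; eq = IsFunctor.F-resp isF eq }

module FamGroupoid (A : RawGroupoid) (isA : IsGroupoid A) where
  open HEqProperties A isA public
  open IsGroupoid isA

  comp-≋ : ∀ {x y} (φ : FamHom A x y) {i i' : Idx x} → i ≡ i' → HEq A (comp φ i) (comp φ i')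
  comp-≋ φ refl = ≋-refl

  famInv : ∀ {x y} → FamHom A x y → FamHom A y x
  famInv φ = record
    { π = π⁻ φ ; π⁻ = π φ ; π⁻∘π = π∘π⁻ φ ; π∘π⁻ = π⁻∘π φ
    ; comp = λ j → subst₂ (Hom A) (cong val (π∘π⁻ φ j)) refl (inv (comp φ (π⁻ φ j))) }

  Fam-isGroupoid : IsGroupoid (T A)
  Fam-isGroupoid = record
    { ≈-equiv = record
        { refl = λ i → refl , ≋-refl
        ; sym = λ p i → sym (proj₁ (p i)) , ≋-sym (proj₂ (p i))
        ; trans = λ p q i → trans (proj₁ (p i)) (proj₁ (q i)) , ≋-trans (proj₂ (p i)) (proj₂ (q i)) }
    ; ∘-resp-≈ = λ {_} {_} {_} {f} {f'} {g} {g'} pg pf i →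
        trans (cong (π g) (proj₁ (pf i))) (proj₁ (pg (π f' i))) ,
        ∘-resp-≋ (≋-trans (comp-≋ g (proj₁ (pf i))) (proj₂ (pg (π f' i)))) (proj₂ (pf i))
    ; assoc = λ f g h i → refl , ≈⇒≋ (assoc _ _ _)
    ; identityˡ = λ f i → refl , ≈⇒≋ (identityˡ _)
    ; identityʳ = λ f i → refl , ≈⇒≋ (identityʳ _)
    ; invertible = λ φ → famInv φ ,
        (λ i → π⁻∘π φ i ,
           ≋-trans (∘-resp-≋ (≋-trans (subst₂-≋ _ _ _) (inv-resp-≋ (comp-≋ φ (π⁻∘π φ i)))) ≋-refl)
                   (≈⇒≋ (proj₁ (proj₂ (invertible (comp φ i)))))) ,
        (λ j → π∘π⁻ φ j ,
           ≋-trans (∘-resp-≋ ≋-refl (subst₂-≋ _ _ _))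
                   (≋-trans (≈⇒≋ (proj₂ (proj₂ (invertible (comp φ (π⁻ φ j))))))
                            (id-≋ (cong val (π∘π⁻ φ j)))))
    }

  AgreeOnKeys : ∀ {x y x' y'} → FamHom A x y → FamHom A x' y' → Set
  AgreeOnKeys {x} {y} {x'} {y'} φ ψ =
    ∀ (i : Idx x) (i' : Idx x') → key i ≡ key i' →
    key (π φ i) ≡ key (π ψ i') × HEq A (comp φ i) (comp ψ i')

  agreeOnKeys⇒≈ : ∀ {x y} {φ ψ : FamHom A x y} → AgreeOnKeys φ ψ → FamEq A φ ψ
  agreeOnKeys⇒≈ {φ = φ} {ψ} k i = key-injective {i = π φ i} {π ψ i} (proj₁ (k i i refl)) , proj₂ (k i i refl)

  pointwise⇒agreeOnKeys : ∀ {x y y'} {φ : FamHom A x y} {ψ : FamHom A x y'} →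
                          (∀ i → key (π φ i) ≡ key (π ψ i) × HEq A (comp φ i) (comp ψ i)) → AgreeOnKeys φ ψ
  pointwise⇒agreeOnKeys k i i' e with key-injective {i = i} {i'} e
  ... | refl = k i

  pointwise⇒≈ : ∀ {x y} {φ ψ : FamHom A x y} →
                (∀ i → key (π φ i) ≡ key (π ψ i) × HEq A (comp φ i) (comp ψ i)) → FamEq A φ ψ
  pointwise⇒≈ {φ = φ} {ψ} k = agreeOnKeys⇒≈ {φ = φ} {ψ} (pointwise⇒agreeOnKeys {φ = φ} {ψ} k)

  agreeOnKeys⇒≋ : ∀ {x y x' y'} {φ : FamHom A x y} {ψ : FamHom A x' y'} →
                  x ≡ x' → y ≡ y' → AgreeOnKeys φ ψ → HEq (T A) φ ψ
  agreeOnKeys⇒≋ {φ = φ} {ψ} refl refl k = record { src = refl ; tgt = refl ; eq = agreeOnKeys⇒≈ {φ = φ} {ψ} k }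

  ≋⇒agreeOnKeys : ∀ {x y x' y'} {φ : FamHom A x y} {ψ : FamHom A x' y'} → HEq (T A) φ ψ → AgreeOnKeys φ ψ
  ≋⇒agreeOnKeys {φ = φ} record { src = refl ; tgt = refl ; eq = eq } i i' e with key-injective {i = i} {i'} e
  ... | refl = cong key (proj₁ (eq i)) , proj₂ (eq i)

  subst-agreeOnKeys : ∀ {x y y'} (e : y ≡ y') (φ : FamHom A x y) → AgreeOnKeys (subst (FamHom A x) e φ) φ
  subst-agreeOnKeys refl φ i i' e with key-injective {i = i} {i'} e
  ... | refl = refl , ≋-refl

T-isGroupoid : (A : Groupoid) → IsGroupoid (T ∣ A ∣)
T-isGroupoid A = FamGroupoid.Fam-isGroupoid ∣ A ∣ (Groupoid.isGroupoid A)

module _ (A : RawGroupoid) where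
  opaque
    reindexing : (x y : FamObj (Obj A)) (p : Idx x → Idx y) (p⁻ : Idx y → Idx x) →
                 (∀ i → key (p⁻ (p i)) ≡ key i) → (∀ j → key (p (p⁻ j)) ≡ key j) →
                 (∀ i → val (p i) ≡ val i) → FamHom A x y
    reindexing x y p p⁻ p⁻∘p p∘p⁻ val-p = record
      { π = p ; π⁻ = p⁻
      ; π⁻∘π = λ i → key-injective {i = p⁻ (p i)} {i} (p⁻∘p i)
      ; π∘π⁻ = λ j → key-injective {i = p (p⁻ j)} {j} (p∘p⁻ j)
      ; comp = λ i → subst (Hom A (val i)) (sym (val-p i)) (id A) }

  opaque
    unfolding reindexing
    π-reindexing : ∀ x y p p⁻ p⁻∘p p∘p⁻ val-p (i : Idx x) → π (reindexing x y p p⁻ p⁻∘p p∘p⁻ val-p) i ≡ p i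
    π-reindexing x y p p⁻ p⁻∘p p∘p⁻ val-p i = refl

    comp-reindexing : IsGroupoid A → ∀ x y p p⁻ p⁻∘p p∘p⁻ val-p (i : Idx x) →
                      HEq A (comp (reindexing x y p p⁻ p⁻∘p p∘p⁻ val-p) i) (id A {val i})
    comp-reindexing isA x y p p⁻ p⁻∘p p∘p⁻ val-p i = HEqProperties.subst-≋ A isA (sym (val-p i)) (id A)

-- The 2-functor !

fmapO-id : ∀ {X} (x : List (ℕ × X)) → fmapO (λ a → a) x ≡ x
fmapO-id [] = refl
fmapO-id ((d , a) ∷ x) = cong ((d , a) ∷_) (fmapO-id x)

fmapO-∘ : ∀ {X Y Z} (f : Y → Z) (g : X → Y) (x : List (ℕ × X)) →
          fmapO f (fmapO g x) ≡ fmapO (λ a → f (g a)) x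
fmapO-∘ f g [] = refl
fmapO-∘ f g ((d , a) ∷ x) = cong ((d , f (g a)) ∷_) (fmapO-∘ f g x)

fmapO-cong : ∀ {X Y} {f g : X → Y} → (∀ a → f a ≡ g a) → (x : List (ℕ × X)) → fmapO f x ≡ fmapO g x
fmapO-cong p [] = refl
fmapO-cong p ((d , a) ∷ x) = cong₂ (λ u v → (d , u) ∷ v) (p a) (fmapO-cong p x)

module _ {A B : RawGroupoid} (isB : IsGroupoid B) (F : RawFunctor A B) where
  open HEqProperties B isB

  TF₁-spec : ∀ {x y} (φ : FamHom A x y) (i : Idx (fmapO (F₀ F) x)) (i₀ : Idx x) → key i ≡ key i₀ →
             key (π (F₁ (TF F) φ) i) ≡ key (π φ i₀) × HEq B (comp (F₁ (TF F) φ) i) (F₁ F (comp φ i₀))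
  TF₁-spec φ i i₀ e with key-injective {i = backI (F₀ F) i} {i₀} e
  ... | refl = refl , subst₂-≋ _ _ _

  T2-spec : ∀ (G : RawFunctor A B) (θ : NatT F G) x (i : Idx (fmapO (F₀ F) x)) (i₀ : Idx x) → key i ≡ key i₀ →
            key (π (T2 F G θ x) i) ≡ key i₀ × HEq B (comp (T2 F G θ x) i) (θ (val i₀))
  T2-spec G θ x i i₀ e with key-injective {i = backI (F₀ F) i} {i₀} e
  ... | refl = refl , subst₂-≋ _ _ _

module _ {A B : Groupoid} (F : Functor A B) where
  private
    module B = FamGroupoid ∣ B ∣ (Groupoid.isGroupoid B)
    module F = IsFunctor (Functor.isFunctor F)
    F₀F = F₀ ⌊ F ⌋
    F-resp-≋ = F₁-resp-≋ ⌊ F ⌋ (Functor.isFunctor F)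

  TF-isFunctor : IsFunctor (TF ⌊ F ⌋)
  TF-isFunctor = record
    { F-resp = λ p i →
        cong (convI F₀F) (proj₁ (p (backI F₀F i))) ,
        B.≋-trans (B.subst₂-≋ _ _ _)
          (B.≋-trans (F-resp-≋ (proj₂ (p (backI F₀F i)))) (B.≋-sym (B.subst₂-≋ _ _ _)))
    ; F-id = λ i →
        convI-backI F₀F i ,
        B.≋-trans (B.subst₂-≋ _ _ _) (B.≋-trans (B.≈⇒≋ F.F-id) (B.id-≋ (sym (val-back F₀F i))))
    ; F-∘ = λ f g i →
        cong (λ z → convI F₀F (π g z)) (sym (backI-convI F₀F (π f (backI F₀F i)))) ,
        B.≋-trans (B.subst₂-≋ _ _ _)
          (B.≋-trans (B.≈⇒≋ (F.F-∘ _ _))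
             (B.∘-resp-≋
               (B.≋-sym (B.≋-trans (B.subst₂-≋ _ _ _)
                 (F-resp-≋ (FamGroupoid.comp-≋ ∣ A ∣ (Groupoid.isGroupoid A) g
                             (backI-convI F₀F (π f (backI F₀F i)))))))
               (B.≋-sym (B.subst₂-≋ _ _ _))))
    }

TF-id : ∀ (A : Groupoid) → TF (idR ∣ A ∣) ≐ idR (T ∣ A ∣)
TF-id A = record
  { obj = fmapO-id
  ; hom = λ {x} {y} f → A.agreeOnKeys⇒≋ (fmapO-id x) (fmapO-id y) (TF₁-spec isA (idR ∣ A ∣) f) }
  where
  isA = Groupoid.isGroupoid A
  module A = FamGroupoid ∣ A ∣ isA

TF-∘ : ∀ {A B C} (F : Functor A B) (G : Functor B C) → TF (⌊ G ⌋ ∘R ⌊ F ⌋) ≐ (TF ⌊ G ⌋ ∘R TF ⌊ F ⌋)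
TF-∘ {A} {B} {C} F G = record
  { obj = λ x → sym (fmapO-∘ (F₀ ⌊ G ⌋) (F₀ ⌊ F ⌋) x)
  ; hom = λ {x} {y} φ →
      C.agreeOnKeys⇒≋ (sym (fmapO-∘ (F₀ ⌊ G ⌋) (F₀ ⌊ F ⌋) x)) (sym (fmapO-∘ (F₀ ⌊ G ⌋) (F₀ ⌊ F ⌋) y)) λ i i' e →
        let i₁ = backI (F₀ ⌊ G ⌋) i'
            i₀ = backI (F₀ ⌊ F ⌋) i₁
            at-GF = TF₁-spec isC (⌊ G ⌋ ∘R ⌊ F ⌋) φ i i₀ e
            at-G = TF₁-spec isC ⌊ G ⌋ (F₁ (TF ⌊ F ⌋) φ) i' i₁ refl
            at-F = TF₁-spec isB ⌊ F ⌋ φ i₁ i₀ refl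
        in trans (proj₁ at-GF) (sym (trans (proj₁ at-G) (proj₁ at-F))) ,
           C.≋-trans (proj₂ at-GF)
             (C.≋-sym (C.≋-trans (proj₂ at-G) (F₁-resp-≋ ⌊ G ⌋ (Functor.isFunctor G) (proj₂ at-F))))
  }
  where
  isB = Groupoid.isGroupoid B
  isC = Groupoid.isGroupoid C
  module C = FamGroupoid ∣ C ∣ isC

module _ {A B : Groupoid} where
  private
    isB = Groupoid.isGroupoid B
    module B = FamGroupoid ∣ B ∣ isB

  T2-natural : ∀ (F G : Functor A B) (θ : NatT ⌊ F ⌋ ⌊ G ⌋) → IsNatural ⌊ F ⌋ ⌊ G ⌋ θ →
               IsNatural (TF ⌊ F ⌋) (TF ⌊ G ⌋) (T2 ⌊ F ⌋ ⌊ G ⌋ θ)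
  T2-natural F G θ natural {x} {y} φ =
    B.agreeOnKeys⇒≈ {φ = famComp ∣ B ∣ (T2 ⌊ F ⌋ ⌊ G ⌋ θ y) (F₁ (TF ⌊ F ⌋) φ)}
                    {ψ = famComp ∣ B ∣ (F₁ (TF ⌊ G ⌋) φ) (T2 ⌊ F ⌋ ⌊ G ⌋ θ x)} λ i i' e →
      let i₀ = backI (F₀ ⌊ F ⌋) i
          Fφ = TF₁-spec isB ⌊ F ⌋ φ i i₀ refl
          θy = T2-spec isB ⌊ F ⌋ ⌊ G ⌋ θ y (π (F₁ (TF ⌊ F ⌋) φ) i) (π φ i₀) (proj₁ Fφ)
          θx = T2-spec isB ⌊ F ⌋ ⌊ G ⌋ θ x i' i₀ (sym e)
          Gφ = TF₁-spec isB ⌊ G ⌋ φ (π (T2 ⌊ F ⌋ ⌊ G ⌋ θ x) i') i₀ (proj₁ θx)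
      in trans (proj₁ θy) (sym (proj₁ Gφ)) ,
         B.≋-trans (B.∘-resp-≋ (proj₂ θy) (proj₂ Fφ))
           (B.≋-trans (B.≈⇒≋ (natural (comp φ i₀))) (B.≋-sym (B.∘-resp-≋ (proj₂ Gφ) (proj₂ θx))))

  T2-id : ∀ (F : Functor A B) x → _≈_ (T ∣ B ∣) (T2 ⌊ F ⌋ ⌊ F ⌋ (idN ⌊ F ⌋) x) (id (T ∣ B ∣))
  T2-id F x = B.agreeOnKeys⇒≈ {φ = T2 ⌊ F ⌋ ⌊ F ⌋ (idN ⌊ F ⌋) x} {ψ = famId ∣ B ∣} λ i i' e →
    let at = T2-spec isB ⌊ F ⌋ ⌊ F ⌋ (idN ⌊ F ⌋) x i (backI (F₀ ⌊ F ⌋) i') e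
    in proj₁ at , B.≋-trans (proj₂ at) (B.id-≋ (sym (val-back (F₀ ⌊ F ⌋) i')))

  T2-vcomp : ∀ (F G H : Functor A B) (θ : NatT ⌊ F ⌋ ⌊ G ⌋) (ψ : NatT ⌊ G ⌋ ⌊ H ⌋) →
             IsNatural ⌊ F ⌋ ⌊ G ⌋ θ → IsNatural ⌊ G ⌋ ⌊ H ⌋ ψ → ∀ x →
             _≈_ (T ∣ B ∣) (T2 ⌊ F ⌋ ⌊ H ⌋ (vcomp {F = ⌊ F ⌋} {G = ⌊ G ⌋} {H = ⌊ H ⌋} ψ θ) x)
                           (_∘_ (T ∣ B ∣) (T2 ⌊ G ⌋ ⌊ H ⌋ ψ x) (T2 ⌊ F ⌋ ⌊ G ⌋ θ x))
  T2-vcomp F G H θ ψ _ _ x =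
    B.agreeOnKeys⇒≈ {φ = T2 ⌊ F ⌋ ⌊ H ⌋ (vcomp {F = ⌊ F ⌋} {G = ⌊ G ⌋} {H = ⌊ H ⌋} ψ θ) x}
                    {ψ = famComp ∣ B ∣ (T2 ⌊ G ⌋ ⌊ H ⌋ ψ x) (T2 ⌊ F ⌋ ⌊ G ⌋ θ x)} λ i i' e →
      let i₀ = backI (F₀ ⌊ F ⌋) i'
          ψθ = T2-spec isB ⌊ F ⌋ ⌊ H ⌋ (vcomp {F = ⌊ F ⌋} {G = ⌊ G ⌋} {H = ⌊ H ⌋} ψ θ) x i i₀ e
          θx = T2-spec isB ⌊ F ⌋ ⌊ G ⌋ θ x i' i₀ refl
          ψx = T2-spec isB ⌊ G ⌋ ⌊ H ⌋ ψ x (π (T2 ⌊ F ⌋ ⌊ G ⌋ θ x) i') i₀ (proj₁ θx)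
      in trans (proj₁ ψθ) (sym (proj₁ ψx)) , B.≋-trans (proj₂ ψθ) (B.≋-sym (B.∘-resp-≋ (proj₂ ψx) (proj₂ θx)))

T2-whiskerL : ∀ {A B C} (F G : Functor A B) (H : Functor B C) (θ : NatT ⌊ F ⌋ ⌊ G ⌋) →
              IsNatural ⌊ F ⌋ ⌊ G ⌋ θ → ∀ x →
              HEq (T ∣ C ∣) (T2 (⌊ H ⌋ ∘R ⌊ F ⌋) (⌊ H ⌋ ∘R ⌊ G ⌋) (whiskerL {F = ⌊ F ⌋} {G = ⌊ G ⌋} ⌊ H ⌋ θ) x)
                            (F₁ (TF ⌊ H ⌋) (T2 ⌊ F ⌋ ⌊ G ⌋ θ x))
T2-whiskerL {A} {B} {C} F G H θ _ x =
  C.agreeOnKeys⇒≋ (sym (fmapO-∘ (F₀ ⌊ H ⌋) (F₀ ⌊ F ⌋) x)) (sym (fmapO-∘ (F₀ ⌊ H ⌋) (F₀ ⌊ G ⌋) x)) λ i i' e →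
    let i₁ = backI (F₀ ⌊ H ⌋) i'
        i₀ = backI (F₀ ⌊ F ⌋) i₁
        Hθ = T2-spec isC (⌊ H ⌋ ∘R ⌊ F ⌋) (⌊ H ⌋ ∘R ⌊ G ⌋) (whiskerL {F = ⌊ F ⌋} {G = ⌊ G ⌋} ⌊ H ⌋ θ) x i i₀ e
        H! = TF₁-spec isC ⌊ H ⌋ (T2 ⌊ F ⌋ ⌊ G ⌋ θ x) i' i₁ refl
        θx = T2-spec isB ⌊ F ⌋ ⌊ G ⌋ θ x i₁ i₀ refl
    in trans (proj₁ Hθ) (sym (trans (proj₁ H!) (proj₁ θx))) ,
       C.≋-trans (proj₂ Hθ) (C.≋-sym (C.≋-trans (proj₂ H!) (F₁-resp-≋ ⌊ H ⌋ (Functor.isFunctor H) (proj₂ θx))))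
  where
  isB = Groupoid.isGroupoid B
  isC = Groupoid.isGroupoid C
  module C = FamGroupoid ∣ C ∣ isC

T2-whiskerR : ∀ {A B C} (F G : Functor A B) (K : Functor C A) (θ : NatT ⌊ F ⌋ ⌊ G ⌋) →
              IsNatural ⌊ F ⌋ ⌊ G ⌋ θ → ∀ x →
              HEq (T ∣ B ∣) (T2 (⌊ F ⌋ ∘R ⌊ K ⌋) (⌊ G ⌋ ∘R ⌊ K ⌋) (whiskerR {F = ⌊ F ⌋} {G = ⌊ G ⌋} ⌊ K ⌋ θ) x)
                            (T2 ⌊ F ⌋ ⌊ G ⌋ θ (F₀ (TF ⌊ K ⌋) x))
T2-whiskerR {A} {B} {C} F G K θ _ x =
  B.agreeOnKeys⇒≋ (sym (fmapO-∘ (F₀ ⌊ F ⌋) (F₀ ⌊ K ⌋) x)) (sym (fmapO-∘ (F₀ ⌊ G ⌋) (F₀ ⌊ K ⌋) x)) λ i i' e →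
    let i₁ = backI (F₀ ⌊ F ⌋) i'
        i₀ = backI (F₀ ⌊ K ⌋) i₁
        θK = T2-spec isB (⌊ F ⌋ ∘R ⌊ K ⌋) (⌊ G ⌋ ∘R ⌊ K ⌋) (whiskerR {F = ⌊ F ⌋} {G = ⌊ G ⌋} ⌊ K ⌋ θ) x i i₀ e
        θ! = T2-spec isB ⌊ F ⌋ ⌊ G ⌋ θ (F₀ (TF ⌊ K ⌋) x) i' i₁ refl
    in trans (proj₁ θK) (sym (proj₁ θ!)) ,
       B.≋-trans (proj₂ θK) (B.≋-sym (B.≋-trans (proj₂ θ!) (θ-≋ (val-back (F₀ ⌊ K ⌋) i₁))))
  where
  isB = Groupoid.isGroupoid B
  module B = FamGroupoid ∣ B ∣ isB
  θ-≋ : ∀ {a a'} → a ≡ a' → HEq ∣ B ∣ (θ a) (θ a')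
  θ-≋ refl = B.≋-refl

ηR-isFunctor : ∀ (A : Groupoid) → IsFunctor (ηR ∣ A ∣)
ηR-isFunctor A = record
  { F-resp = λ { p (_ , here) → refl , A.≈⇒≋ p }
  ; F-id = λ { (_ , here) → refl , A.≋-refl }
  ; F-∘ = λ { f g (_ , here) → refl , A.≋-refl } }
  where module A = FamGroupoid ∣ A ∣ (Groupoid.isGroupoid A)

ηR-natural : ∀ {A B} (F : Functor A B) → (ηR ∣ B ∣ ∘R ⌊ F ⌋) ≐ (TF ⌊ F ⌋ ∘R ηR ∣ A ∣)
ηR-natural {A} {B} F = record
  { obj = λ a → refl
  ; hom = λ f → B.agreeOnKeys⇒≋ refl refl λ { (_ , here) (_ , here) e → refl , B.≋-refl } }
  where module B = FamGroupoid ∣ B ∣ (Groupoid.isGroupoid B)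

ηR-2natural : ∀ {A B} (F G : Functor A B) (θ : NatT ⌊ F ⌋ ⌊ G ⌋) → IsNatural ⌊ F ⌋ ⌊ G ⌋ θ → ∀ a →
              HEq (T ∣ B ∣) (F₁ (ηR ∣ B ∣) (θ a)) (T2 ⌊ F ⌋ ⌊ G ⌋ θ (η₀ a))
ηR-2natural {A} {B} F G θ _ a = B.agreeOnKeys⇒≋ refl refl λ { (_ , here) (_ , here) e → refl , B.≋-refl }
  where module B = FamGroupoid ∣ B ∣ (Groupoid.isGroupoid B)

-- Flattening a family of families

EntryAt : ∀ {X : Set} → List (ℕ × X) → ℕ → X → Set
EntryAt l k a = Σ (k ∈ₖ l) (λ m → val (k , m) ≡ a)

moveEntry : ∀ {X} {l : List (ℕ × X)} {k k' a} → k ≡ k' → EntryAt l k a → EntryAt l k' a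
moveEntry refl e = e

private
  gap-≡ : ∀ {m n} → m < n → suc (m + (n ∸ suc m)) ≡ n
  gap-≡ = m+[n∸m]≡n

  gap-shift : ∀ {m n} k → m < n → suc (m + suc ((n ∸ suc m) + k)) ≡ suc (n + k)
  gap-shift {m} {n} k m<n = cong suc (begin
    m + suc (n ∸ suc m + k)   ≡⟨ +-suc m _ ⟩
    suc (m + (n ∸ suc m + k)) ≡⟨ cong suc (sym (+-assoc m (n ∸ suc m) k)) ⟩
    suc (m + (n ∸ suc m)) + k ≡⟨ cong (_+ k) (gap-≡ m<n) ⟩
    n + k                     ∎)
    where open ≡-Reasoning

  <ᵇ-true : ∀ {m n} → (m <ᵇ n) ≡ true → m < n
  <ᵇ-true {m} {n} eq = <ᵇ⇒< m n (subst IsTrue (sym eq) tt)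

  <ᵇ-false : ∀ {m n} → (m <ᵇ n) ≡ false → n ≤ m
  <ᵇ-false eq = ≮⇒≥ (λ m<n → subst IsTrue eq (<⇒<ᵇ m<n))

  fresh-head : ∀ {X} {d k : ℕ} {b : X} {l} → ¬ (k ∈ₖ ((d , b) ∷ l)) → d ≤ k → d < k
  fresh-head nk d≤k = ≤∧≢⇒< d≤k (λ { refl → nk here })

  fresh-tail : ∀ {X} {d k : ℕ} {b : X} {l} → ¬ (k ∈ₖ ((d , b) ∷ l)) → d ≤ k → ¬ ((k ∸ suc d) ∈ₖ l)
  fresh-tail nk d≤k m = nk (subst (_∈ₖ _) (gap-≡ (fresh-head nk d≤k)) (there m))

insertF-new : ∀ {X} {k} {a : X} (l : List (ℕ × X)) → ¬ (k ∈ₖ l) → EntryAt (insertF k a l) k a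
insertF-new [] nk = here , refl
insertF-new {k = k} ((d , b) ∷ l) nk with k <ᵇ d in eq
... | true = here , refl
... | false with insertF-new l (fresh-tail nk (<ᵇ-false eq))
... | m , v = moveEntry (gap-≡ (fresh-head nk (<ᵇ-false eq))) (there m , v)

insertF-old : ∀ {X} {k k'} {a c : X} (l : List (ℕ × X)) → ¬ (k ∈ₖ l) → k ≢ k' →
              EntryAt l k' c → EntryAt (insertF k a l) k' c
insertF-old {k = k} ((d , b) ∷ l) nk ne (here , v) with k <ᵇ d in eq
... | true = moveEntry (gap-≡ (<ᵇ-true eq)) (there here , v)
... | false = here , v
insertF-old {k = k} ((d , b) ∷ l) nk ne (there {k = k''} m , v) with k <ᵇ d in eq
... | true = moveEntry (gap-shift k'' (<ᵇ-true eq)) (there (there m) , v)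
... | false with insertF-old l (fresh-tail nk (<ᵇ-false eq))
                 (λ e → ne (trans (sym (gap-≡ (fresh-head nk (<ᵇ-false eq)))) (cong (λ z → suc (d + z)) e)))
                 (m , v)
... | m' , v' = there m' , v'

insertF-inv : ∀ {X} {k k'} {a c : X} (l : List (ℕ × X)) → ¬ (k ∈ₖ l) → EntryAt (insertF k a l) k' c →
              (k' ≡ k × c ≡ a) ⊎ EntryAt l k' c
insertF-inv [] nk (here , v) = inj₁ (refl , sym v)
insertF-inv {k = k} ((d , b) ∷ l) nk at with k <ᵇ d in eq
insertF-inv ((d , b) ∷ l) nk (here , v) | true = inj₁ (refl , sym v)
insertF-inv ((d , b) ∷ l) nk (there here , v) | true =
  inj₂ (moveEntry (sym (gap-≡ (<ᵇ-true eq))) (here , v))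
insertF-inv ((d , b) ∷ l) nk (there (there {k = k''} m) , v) | true =
  inj₂ (moveEntry (sym (gap-shift k'' (<ᵇ-true eq))) (there m , v))
insertF-inv ((d , b) ∷ l) nk (here , v) | false = inj₂ (here , v)
insertF-inv ((d , b) ∷ l) nk (there m , v) | false with insertF-inv l (fresh-tail nk (<ᵇ-false eq)) (m , v)
... | inj₁ (refl , v') = inj₁ (gap-≡ (fresh-head nk (<ᵇ-false eq)) , v')
... | inj₂ (m' , v') = inj₂ (there m' , v')

Fresh : ∀ {X : Set} → ℕ → List (ℕ × X) → Set
Fresh k L = ∀ {a} → ¬ ((k , a) ∈ L)

DistinctKeys : ∀ {X : Set} → List (ℕ × X) → Set
DistinctKeys [] = ⊤
DistinctKeys ((k , a) ∷ L) = Fresh k L × DistinctKeys L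

fromAbs⁻ : ∀ {X} (L : List (ℕ × X)) → DistinctKeys L → ∀ {k a} → EntryAt (fromAbs L) k a → (k , a) ∈ L
fromAbs-fresh : ∀ {X} (L : List (ℕ × X)) → DistinctKeys L → ∀ {k} → Fresh k L → ¬ (k ∈ₖ fromAbs L)
fromAbs-fresh L D fr m = fr (fromAbs⁻ L D (m , refl))
fromAbs⁻ [] D (() , v)
fromAbs⁻ ((k₀ , a₀) ∷ L) (fr , D) at with insertF-inv (fromAbs L) (fromAbs-fresh L D fr) at
... | inj₁ (refl , refl) = here refl
... | inj₂ at' = there (fromAbs⁻ L D at')

fromAbs⁺ : ∀ {X} (L : List (ℕ × X)) → DistinctKeys L → ∀ {k a} → (k , a) ∈ L → EntryAt (fromAbs L) k a
fromAbs⁺ ((k₀ , a₀) ∷ L) (fr , D) (here refl) = insertF-new (fromAbs L) (fromAbs-fresh L D fr)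
fromAbs⁺ ((k₀ , a₀) ∷ L) (fr , D) (there h) =
  insertF-old (fromAbs L) (fromAbs-fresh L D fr) (λ { refl → fr h }) (fromAbs⁺ L D h)

toAbs⁺ : ∀ {X} {b} (l : List (ℕ × X)) {k a} → EntryAt l k a → (b + k , a) ∈ toAbs b l
toAbs⁺ ((d , a') ∷ l) (here , refl) = here refl
toAbs⁺ {b = b} ((d , a') ∷ l) {a = a} (there {k = k} m , v) =
  there (subst (λ k → (k , a) ∈ toAbs (b + suc d) l) (+-assoc b (suc d) k) (toAbs⁺ l (m , v)))

toAbs⁻ : ∀ {X} {b} (l : List (ℕ × X)) {k' a} → (k' , a) ∈ toAbs b l →
         Σ ℕ λ k → k' ≡ b + k × EntryAt l k a
toAbs⁻ ((d , a') ∷ l) (here refl) = d , refl , here , refl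
toAbs⁻ {b = b} ((d , a') ∷ l) (there h) with toAbs⁻ {b = b + suc d} l h
... | k , e , m , v = suc (d + k) , trans e (+-assoc b (suc d) k) , there m , v

toAbs-distinct : ∀ {X} {b} (l : List (ℕ × X)) → DistinctKeys (toAbs b l)
toAbs-distinct [] = tt
toAbs-distinct {b = b} ((d , a) ∷ l) = fresh , toAbs-distinct l
  where
  fresh : Fresh (b + d) (toAbs (b + suc d) l)
  fresh h with toAbs⁻ {b = b + suc d} l h
  ... | k , e , _ = <-irrefl e (begin-strict
        b + d       <⟨ +-monoʳ-< b (n<1+n d) ⟩
        b + suc d   ≤⟨ m≤m+n (b + suc d) k ⟩
        b + suc d + k ∎)
    where open ≤-Reasoning

fmapO-++ : ∀ {X Y} (f : X → Y) (M N : List (ℕ × X)) → fmapO f (M ++ N) ≡ fmapO f M ++ fmapO f N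
fmapO-++ f [] N = refl
fmapO-++ f ((d , a) ∷ M) N = cong ((d , f a) ∷_) (fmapO-++ f M N)

toAbs-fmapO : ∀ {X Y} (f : X → Y) b (l : List (ℕ × X)) → toAbs b (fmapO f l) ≡ fmapO f (toAbs b l)
toAbs-fmapO f b [] = refl
toAbs-fmapO f b ((d , a) ∷ l) = cong ((b + d , f a) ∷_) (toAbs-fmapO f (b + suc d) l)

insertF-fmapO : ∀ {X Y} (f : X → Y) k a (l : List (ℕ × X)) →
                insertF k (f a) (fmapO f l) ≡ fmapO f (insertF k a l)
insertF-fmapO f k a [] = refl
insertF-fmapO f k a ((d , b) ∷ l) with k <ᵇ d
... | true = refl
... | false = cong ((d , f b) ∷_) (insertF-fmapO f _ a l)

fromAbs-fmapO : ∀ {X Y} (f : X → Y) (L : List (ℕ × X)) → fromAbs (fmapO f L) ≡ fmapO f (fromAbs L)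
fromAbs-fmapO f [] = refl
fromAbs-fmapO f ((k , a) ∷ L) =
  trans (cong (insertF k (f a)) (fromAbs-fmapO f L)) (insertF-fmapO f k a (fromAbs L))

map-fmapO : ∀ {X Y} (f : X → Y) (h : ℕ → ℕ) (L : List (ℕ × X)) →
            map (λ ja → h (proj₁ ja) , proj₂ ja) (fmapO f L) ≡ fmapO f (map (λ ja → h (proj₁ ja) , proj₂ ja) L)
map-fmapO f h [] = refl
map-fmapO f h ((d , a) ∷ L) = cong ((h d , f a) ∷_) (map-fmapO f h L)

μ₀-fmapO : ∀ {X Y} (pair : ℕ → ℕ → ℕ) (f : X → Y) (x : FamObj (FamObj X)) →
           μ₀ pair (fmapO (fmapO f) x) ≡ fmapO f (μ₀ pair x)
μ₀-fmapO {X} pair f x = begin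
  fromAbs (concatMap block (toAbs 0 (fmapO (fmapO f) x))) ≡⟨ cong (λ L → fromAbs (concatMap block L)) (toAbs-fmapO (fmapO f) 0 x) ⟩
  fromAbs (concatMap block (fmapO (fmapO f) (toAbs 0 x))) ≡⟨ cong fromAbs (concatMap-block (toAbs 0 x)) ⟩
  fromAbs (fmapO f (concatMap block (toAbs 0 x)))         ≡⟨ fromAbs-fmapO f (concatMap block (toAbs 0 x)) ⟩
  fmapO f (μ₀ pair x)                                     ∎
  where
  open ≡-Reasoning
  block : ∀ {Z : Set} → ℕ × FamObj Z → List (ℕ × Z)
  block iy = map (λ ja → pair (proj₁ iy) (proj₁ ja) , proj₂ ja) (toAbs 0 (proj₂ iy))
  concatMap-block : ∀ (L : List (ℕ × FamObj X)) → concatMap block (fmapO (fmapO f) L) ≡ fmapO f (concatMap block L)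
  concatMap-block [] = refl
  concatMap-block ((i , y) ∷ L) =
    trans (cong₂ _++_ (trans (cong (map _) (toAbs-fmapO f 0 y)) (map-fmapO f (pair i) (toAbs 0 y)))
                      (concatMap-block L))
          (sym (fmapO-++ f (block (i , y)) (concatMap block L)))

++-distinct : ∀ {X} (M : List (ℕ × X)) {N} → DistinctKeys M → DistinctKeys N →
              (∀ {k a b} → (k , a) ∈ M → (k , b) ∈ N → ⊥) → DistinctKeys (M ++ N)
++-distinct [] DM DN disjoint = DN
++-distinct ((k , a) ∷ M) (fr , DM) DN disjoint =
  (λ h → [ fr , disjoint (here refl) ]′ (∈-++⁻ M h)) ,
  ++-distinct M DM DN (λ h h' → disjoint (there h) h')

module Multiplication (pair : ℕ → ℕ → ℕ)
                      (pair-injective : ∀ {i j i' j'} → pair i j ≡ pair i' j' → i ≡ i' × j ≡ j') where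

  module _ {X : Set} where

    tag : ℕ → ℕ × X → ℕ × X
    tag i ja = pair i (proj₁ ja) , proj₂ ja

    block : ℕ × FamObj X → List (ℕ × X)
    block iy = map (tag (proj₁ iy)) (toAbs 0 (proj₂ iy))

    entries : FamObj (FamObj X) → List (ℕ × X)
    entries x = concatMap block (toAbs 0 x)

    tag-∈⁻ : ∀ {i} (M : List (ℕ × X)) {k a} → (k , a) ∈ map (tag i) M →
             Σ ℕ λ j → k ≡ pair i j × (j , a) ∈ M
    tag-∈⁻ M h with ∈-map⁻ (tag _) h
    ... | (j , _) , h' , refl = j , refl , h'

    tag-distinct : ∀ {i} (M : List (ℕ × X)) → DistinctKeys M → DistinctKeys (map (tag i) M)
    tag-distinct [] D = tt
    tag-distinct ((j , a) ∷ M) (fr , D) = fresh , tag-distinct M D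
      where
      fresh : Fresh (pair _ j) (map (tag _) M)
      fresh h with tag-∈⁻ M h
      ... | j' , e , h' = fr (subst (λ j → (j , _) ∈ M) (sym (proj₂ (pair-injective e))) h')

    concatMap-block⁺ : ∀ (L : List (ℕ × FamObj X)) {i y j a} → (i , y) ∈ L → (j , a) ∈ toAbs 0 y →
                       (pair i j , a) ∈ concatMap block L
    concatMap-block⁺ L h h' = ∈-concatMap⁺ block (lose h (∈-map⁺ (tag _) h'))

    record InBlock (L : List (ℕ × FamObj X)) (k : ℕ) (a : X) : Set where
      constructor inBlock
      field
        {i}    : ℕ
        {y}    : FamObj X
        {j}    : ℕ
        key≡   : k ≡ pair i j
        outer∈ : (i , y) ∈ L
        inner∈ : (j , a) ∈ toAbs 0 y

    concatMap-block⁻ : ∀ (L : List (ℕ × FamObj X)) {k a} → (k , a) ∈ concatMap block L → InBlock L k a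
    concatMap-block⁻ L h with find (∈-concatMap⁻ block h)
    ... | (i , y) , h₁ , h₂ with tag-∈⁻ (toAbs 0 y) h₂
    ... | j , e , h₃ = inBlock e h₁ h₃

    concatMap-block-distinct : ∀ (L : List (ℕ × FamObj X)) → DistinctKeys L → DistinctKeys (concatMap block L)
    concatMap-block-distinct [] D = tt
    concatMap-block-distinct ((i , y) ∷ L) (fr , D) =
      ++-distinct (block (i , y)) (tag-distinct (toAbs 0 y) (toAbs-distinct y))
                  (concatMap-block-distinct L D) disjoint
      where
      disjoint : ∀ {k a b} → (k , a) ∈ block (i , y) → (k , b) ∈ concatMap block L → ⊥
      disjoint h h' with tag-∈⁻ (toAbs 0 y) h | concatMap-block⁻ L h'
      ... | j , e , _ | inBlock e' h₁ _ =
        fr (subst (λ i → (i , _) ∈ L) (sym (proj₁ (pair-injective (trans (sym e) e')))) h₁)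

    entries-distinct : (x : FamObj (FamObj X)) → DistinctKeys (entries x)
    entries-distinct x = concatMap-block-distinct (toAbs 0 x) (toAbs-distinct x)

    record Split {x : FamObj (FamObj X)} (K : Idx (μ₀ pair x)) : Set where
      constructor split
      field
        outer : Idx x
        inner : Idx (val outer)
        key-split : key K ≡ pair (key outer) (key inner)
        val-split : val inner ≡ val K

    opaque
      μIdx-entry : {x : FamObj (FamObj X)} (i : Idx x) (j : Idx (val i)) →
                   EntryAt (μ₀ pair x) (pair (key i) (key j)) (val j)
      μIdx-entry {x} i j =
        fromAbs⁺ (entries x) (entries-distinct x)
          (concatMap-block⁺ (toAbs 0 x) (toAbs⁺ x (proj₂ i , refl)) (toAbs⁺ (val i) (proj₂ j , refl)))

      μIdx : {x : FamObj (FamObj X)} (i : Idx x) (j : Idx (val i)) → Idx (μ₀ pair x)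
      μIdx i j = pair (key i) (key j) , proj₁ (μIdx-entry i j)

      key-μIdx : {x : FamObj (FamObj X)} (i : Idx x) (j : Idx (val i)) → key (μIdx i j) ≡ pair (key i) (key j)
      key-μIdx i j = refl

      val-μIdx : {x : FamObj (FamObj X)} (i : Idx x) (j : Idx (val i)) → val (μIdx i j) ≡ val j
      val-μIdx i j = proj₂ (μIdx-entry i j)

      μsplit : (x : FamObj (FamObj X)) (K : Idx (μ₀ pair x)) → Split {x = x} K
      μsplit x K with concatMap-block⁻ (toAbs 0 x) (fromAbs⁻ (entries x) (entries-distinct x) (proj₂ K , refl))
      ... | inBlock e h₁ h₂ with toAbs⁻ x h₁ | toAbs⁻ _ h₂
      ... | i , refl , mi , vi | j , refl , mj , vj =
            split (i , mi) (castIdx (sym vi) (j , mj))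
                  (trans e (cong (pair i) (sym (key-castIdx (sym vi) (j , mj)))))
                  (trans (val-castIdx (sym vi) (j , mj)) vj)

    open Split public

    split-keys : (x : FamObj (FamObj X)) (K : Idx (μ₀ pair x)) {a b : ℕ} → key K ≡ pair a b →
                 key (outer (μsplit x K)) ≡ a × key (inner (μsplit x K)) ≡ b
    split-keys x K e = pair-injective (trans (sym (key-split (μsplit x K))) e)

    val-μ : {x : FamObj (FamObj X)} (K : Idx (μ₀ pair x)) (i : Idx x) (j : Idx (val i)) →
            key K ≡ pair (key i) (key j) → val K ≡ val j
    val-μ K i j e = trans (cong val (key-injective {i = K} {μIdx i j} (trans e (sym (key-μIdx i j))))) (val-μIdx i j)

  cong-keys₂ : ∀ {X Z : Set} {x : FamObj (FamObj X)} (F : (i : Idx x) → Idx (val i) → Z)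
               {i i' : Idx x} {j : Idx (val i)} {j' : Idx (val i')} →
               key i ≡ key i' → key j ≡ key j' → F i j ≡ F i' j'
  cong-keys₂ F {i} {i'} {j} {j'} e e' with keys-injective {i = i} {i'} {j} {j'} e e'
  ... | refl = refl

  module _ {A : RawGroupoid} {x y : FamObj (FamObj (Obj A))} (φ : FamHom (T A) x y) where

    μ₁-π : Idx (μ₀ pair x) → Idx (μ₀ pair y)
    μ₁-π K = μIdx (π φ i) (π (comp φ i) (inner s))
      where s = μsplit x K ; i = outer s

    transport-inner : (i' : Idx y) → Idx (val i') → Idx (val (π φ (π⁻ φ i')))
    transport-inner i' = castIdx (cong val (sym (π∘π⁻ φ i')))

    μ₁-π⁻ : Idx (μ₀ pair y) → Idx (μ₀ pair x)
    μ₁-π⁻ K' = μIdx (π⁻ φ i') (π⁻ (comp φ (π⁻ φ i')) (transport-inner i' (inner s)))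
      where s = μsplit y K' ; i' = outer s

    private
      π⁻-inner-key : (i : Idx x) (j : Idx (val i)) (i₀ : Idx x) → i₀ ≡ i → (p : val (π φ i) ≡ val (π φ i₀))
                     (j' : Idx (val (π φ i))) → key j' ≡ key (π (comp φ i) j) →
                     key (π⁻ (comp φ i₀) (castIdx p j')) ≡ key j
      π⁻-inner-key i j .i refl refl j' e with key-injective {i = j'} {π (comp φ i) j} e
      ... | refl = cong key (π⁻∘π (comp φ i) j)

      π⁻-keys : (i : Idx x) (j : Idx (val i)) (i' : Idx y) (j' : Idx (val i')) →
                key i' ≡ key (π φ i) → key j' ≡ key (π (comp φ i) j) →
                key (π⁻ φ i') ≡ key i × key (π⁻ (comp φ (π⁻ φ i')) (transport-inner i' j')) ≡ key j
      π⁻-keys i j i' j' e e' with key-injective {i = i'} {π φ i} e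
      ... | refl = cong key (π⁻∘π φ i) , π⁻-inner-key i j (π⁻ φ (π φ i)) (π⁻∘π φ i) _ j' e'

    μ₁-π⁻∘π : ∀ K → μ₁-π⁻ (μ₁-π K) ≡ K
    μ₁-π⁻∘π K = key-injective {i = μ₁-π⁻ (μ₁-π K)} {K}
      (trans (key-μIdx _ _) (trans (cong₂ pair (proj₁ keys) (proj₂ keys)) (sym (key-split s))))
      where
      s = μsplit x K
      s' = μsplit y (μ₁-π K)
      keys' = split-keys y (μ₁-π K) (key-μIdx _ _)
      keys = π⁻-keys (outer s) (inner s) (outer s') (inner s') (proj₁ keys') (proj₂ keys')

    μ₁-π∘π⁻ : ∀ K' → μ₁-π (μ₁-π⁻ K') ≡ K'
    μ₁-π∘π⁻ K' = key-injective {i = μ₁-π (μ₁-π⁻ K')} {K'}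
      (trans (key-μIdx _ _)
      (trans (cong-keys₂ (λ a b → pair (key (π φ a)) (key (π (comp φ a) b))) (proj₁ keys) (proj₂ keys))
      (trans (cong₂ pair (cong key (π∘π⁻ φ i'))
                         (trans (cong key (π∘π⁻ (comp φ (π⁻ φ i')) (transport-inner i' j')))
                                (key-castIdx (cong val (sym (π∘π⁻ φ i'))) j')))
             (sym (key-split s')))))
      where
      s' = μsplit y K'
      i' = outer s'
      j' = inner s'
      keys = split-keys x (μ₁-π⁻ K') (key-μIdx _ _)

    opaque
      μ₁ : FamHom A (μ₀ pair x) (μ₀ pair y)
      μ₁ = record
        { π = μ₁-π ; π⁻ = μ₁-π⁻ ; π⁻∘π = μ₁-π⁻∘π ; π∘π⁻ = μ₁-π∘π⁻
        ; comp = λ K → let s = μsplit x K in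
            subst₂ (Hom A) (val-split s) (sym (val-μIdx _ _)) (comp (comp φ (outer s)) (inner s)) }

  μR : (A : Groupoid) → RawFunctor (T (T ∣ A ∣)) (T ∣ A ∣)
  μR A = record { F₀ = μ₀ pair ; F₁ = μ₁ }

  module _ (A : RawGroupoid) (isA : IsGroupoid A) where
    open FamGroupoid A isA

    opaque
      unfolding μ₁
      μ₁-spec : ∀ {x y} (φ : FamHom (T A) x y) (K : Idx (μ₀ pair x)) (i : Idx x) (j : Idx (val i)) →
                key K ≡ pair (key i) (key j) →
                key (π (μ₁ φ) K) ≡ pair (key (π φ i)) (key (π (comp φ i) j))
                × HEq A (comp (μ₁ φ) K) (comp (comp φ i) j)
      μ₁-spec {x} φ K i j e with μsplit x K | split-keys x K e
      ... | s | ks with keys-injective {i = outer s} {i} {inner s} {j} (proj₁ ks) (proj₂ ks)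
      ... | refl = key-μIdx _ _ , subst₂-≋ _ _ _

  module _ (A : Groupoid) where
    private
      isA = Groupoid.isGroupoid A
      module A = FamGroupoid ∣ A ∣ isA

    μ-spec : ∀ {x y} (φ : FamHom (T ∣ A ∣) x y) (i : Idx x) (j : Idx (val i))
             (m : pair (key i) (key j) ∈ₖ μ₀ pair x) →
             key (π (μ₁ φ) (_ , m)) ≡ pair (key (π φ i)) (key (π (comp φ i) j))
             × HEq ∣ A ∣ (comp (μ₁ φ) (_ , m)) (comp (comp φ i) j)
    μ-spec φ i j m = μ₁-spec ∣ A ∣ isA φ (_ , m) i j refl

    μ-isFunctor : IsFunctor (μR A)
    μ-isFunctor = record
      { F-resp = λ {x} {y} {φ} {ψ} p → A.agreeOnKeys⇒≈ {φ = μ₁ φ} {ψ = μ₁ ψ} λ K K' e →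
          let s = μsplit x K
              i = outer s ; j = inner s
              at-φ = μ₁-spec ∣ A ∣ isA φ K i j (key-split s)
              at-ψ = μ₁-spec ∣ A ∣ isA ψ K' i j (trans (sym e) (key-split s))
              φ≈ψ = A.≋⇒agreeOnKeys (proj₂ (p i)) j j refl
          in trans (proj₁ at-φ) (trans (cong₂ pair (cong key (proj₁ (p i))) (proj₁ φ≈ψ)) (sym (proj₁ at-ψ))) ,
             A.≋-trans (proj₂ at-φ) (A.≋-trans (proj₂ φ≈ψ) (A.≋-sym (proj₂ at-ψ)))
      ; F-id = λ {x} → A.agreeOnKeys⇒≈ {φ = μ₁ (famId (T ∣ A ∣) {x})} {ψ = famId ∣ A ∣} λ K K' e →
          let s = μsplit x K
              at = μ₁-spec ∣ A ∣ isA (famId (T ∣ A ∣)) K (outer s) (inner s) (key-split s)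
          in trans (proj₁ at) (trans (sym (key-split s)) e) ,
             A.≋-trans (proj₂ at) (A.id-≋ (trans (val-split s) (cong val (key-injective {i = K} {K'} e))))
      ; F-∘ = λ {x} f g →
          A.agreeOnKeys⇒≈ {φ = μ₁ (famComp (T ∣ A ∣) g f)} {ψ = famComp ∣ A ∣ (μ₁ g) (μ₁ f)} λ K K' e →
          let s = μsplit x K
              i = outer s ; j = inner s
              at-gf = μ₁-spec ∣ A ∣ isA (famComp (T ∣ A ∣) g f) K i j (key-split s)
              at-f = μ₁-spec ∣ A ∣ isA f K' i j (trans (sym e) (key-split s))
              at-g = μ₁-spec ∣ A ∣ isA g (π (μ₁ f) K') (π f i) (π (comp f i) j) (proj₁ at-f)
          in trans (proj₁ at-gf) (sym (proj₁ at-g)) ,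
             A.≋-trans (proj₂ at-gf) (A.≋-sym (A.∘-resp-≋ (proj₂ at-g) (proj₂ at-f)))
      }

  module _ {X Y : Set} (f : X → Y) (x : FamObj (FamObj X)) (K : Idx (μ₀ pair (fmapO (fmapO f) x))) where
    private
      s = μsplit (fmapO (fmapO f) x) K

    outer₀ : Idx x
    outer₀ = backI (fmapO f) (outer s)

    inner-cast : Idx (fmapO f (val outer₀))
    inner-cast = castIdx (val-back (fmapO f) (outer s)) (inner s)

    inner₀ : Idx (val outer₀)
    inner₀ = backI f inner-cast

    key-inner-cast : key (inner s) ≡ key inner-cast
    key-inner-cast = sym (key-castIdx (val-back (fmapO f) (outer s)) (inner s))

    key-split₀ : key K ≡ pair (key outer₀) (key inner₀)
    key-split₀ = trans (key-split s) (cong (pair (key (outer s))) key-inner-cast)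

  module _ {A B : Groupoid} (F : Functor A B) where
    private
      isB = Groupoid.isGroupoid B
      module B = FamGroupoid ∣ B ∣ isB
      F₀F = F₀ ⌊ F ⌋

    μ-natural : (μR B ∘R TF (TF ⌊ F ⌋)) ≐ (TF ⌊ F ⌋ ∘R μR A)
    μ-natural = record
      { obj = μ₀-fmapO pair F₀F
      ; hom = λ {x} {y} φ → B.agreeOnKeys⇒≋ (μ₀-fmapO pair F₀F x) (μ₀-fmapO pair F₀F y) λ K K' e →
          let s = μsplit (fmapO (fmapO F₀F) x) K
              i₀ = outer₀ F₀F x K ; j₀ = inner₀ F₀F x K
              K₀ = backI F₀F K'
              μ!!F = μ₁-spec ∣ B ∣ isB (F₁ (TF (TF ⌊ F ⌋)) φ) K (outer s) (inner s) (key-split s)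
              !!F = TF₁-spec (T-isGroupoid B) (TF ⌊ F ⌋) φ (outer s) i₀ refl
              !!F-inner = B.≋⇒agreeOnKeys (proj₂ !!F) (inner s) (inner-cast F₀F x K) (key-inner-cast F₀F x K)
              !F-inner = TF₁-spec isB ⌊ F ⌋ (comp φ i₀) (inner-cast F₀F x K) j₀ refl
              !Fμ = TF₁-spec isB ⌊ F ⌋ (μ₁ φ) K' K₀ refl
              μφ = μ₁-spec ∣ A ∣ (Groupoid.isGroupoid A) φ K₀ i₀ j₀ (trans (sym e) (key-split₀ F₀F x K))
          in trans (proj₁ μ!!F)
               (trans (cong₂ pair (proj₁ !!F) (trans (proj₁ !!F-inner) (proj₁ !F-inner)))
                      (sym (trans (proj₁ !Fμ) (proj₁ μφ)))) ,
             B.≋-trans (proj₂ μ!!F) (B.≋-trans (proj₂ !!F-inner) (B.≋-trans (proj₂ !F-inner)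
               (B.≋-sym (B.≋-trans (proj₂ !Fμ) (F₁-resp-≋ ⌊ F ⌋ (Functor.isFunctor F) (proj₂ μφ))))))
      }

  module _ {A B : Groupoid} (F G : Functor A B) (θ : NatT ⌊ F ⌋ ⌊ G ⌋) where
    private
      isB = Groupoid.isGroupoid B
      module B = FamGroupoid ∣ B ∣ isB
      F₀F = F₀ ⌊ F ⌋
      θ-≋ : ∀ {a a'} → a ≡ a' → HEq ∣ B ∣ (θ a) (θ a')
      θ-≋ refl = B.≋-refl

    μ-2natural : IsNatural ⌊ F ⌋ ⌊ G ⌋ θ → ∀ x →
                 HEq (T ∣ B ∣) (μ₁ (T2 (TF ⌊ F ⌋) (TF ⌊ G ⌋) (T2 ⌊ F ⌋ ⌊ G ⌋ θ) x))
                               (T2 ⌊ F ⌋ ⌊ G ⌋ θ (μ₀ pair x))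
    μ-2natural _ x = B.agreeOnKeys⇒≋ (μ₀-fmapO pair F₀F x) (μ₀-fmapO pair (F₀ ⌊ G ⌋) x) λ K K' e →
      let s = μsplit (fmapO (fmapO F₀F) x) K
          i₀ = outer₀ F₀F x K ; j₀ = inner₀ F₀F x K
          K₀ = backI F₀F K'
          key-K₀ = trans (sym e) (key-split₀ F₀F x K)
          μ!!θ = μ₁-spec ∣ B ∣ isB (T2 (TF ⌊ F ⌋) (TF ⌊ G ⌋) (T2 ⌊ F ⌋ ⌊ G ⌋ θ) x) K (outer s) (inner s) (key-split s)
          !!θ = T2-spec (T-isGroupoid B) (TF ⌊ F ⌋) (TF ⌊ G ⌋) (T2 ⌊ F ⌋ ⌊ G ⌋ θ) x (outer s) i₀ refl
          !!θ-inner = B.≋⇒agreeOnKeys (proj₂ !!θ) (inner s) (inner-cast F₀F x K) (key-inner-cast F₀F x K)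
          !θ-inner = T2-spec isB ⌊ F ⌋ ⌊ G ⌋ θ (val i₀) (inner-cast F₀F x K) j₀ refl
          !θμ = T2-spec isB ⌊ F ⌋ ⌊ G ⌋ θ (μ₀ pair x) K' K₀ refl
      in trans (proj₁ μ!!θ)
           (trans (cong₂ pair (proj₁ !!θ) (trans (proj₁ !!θ-inner) (proj₁ !θ-inner)))
                  (sym (trans (proj₁ !θμ) key-K₀))) ,
         B.≋-trans (proj₂ μ!!θ) (B.≋-trans (proj₂ !!θ-inner) (B.≋-trans (proj₂ !θ-inner)
           (B.≋-trans (θ-≋ (sym (val-μ K₀ i₀ j₀ key-K₀))) (B.≋-sym (proj₂ !θμ)))))

  module Split₃ {X : Set} (x : FamObj (FamObj (FamObj X))) (K : Idx (μ₀ pair (μ₀ pair x))) where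
    s₁ = μsplit (μ₀ pair x) K
    s₂ = μsplit x (outer s₁)
    i = outer s₂
    j = inner s₂
    k = castIdx (sym (val-split s₂)) (inner s₁)

    key-k : key k ≡ key (inner s₁)
    key-k = key-castIdx (sym (val-split s₂)) (inner s₁)

    key-split₃ : key K ≡ pair (pair (key i) (key j)) (key k)
    key-split₃ = trans (key-split s₁) (cong₂ pair (key-split s₂) (sym key-k))

  module Split₃' {X : Set} (x : FamObj (FamObj (FamObj X))) (K' : Idx (μ₀ pair (fmapO (μ₀ pair) x))) where
    s₁ = μsplit (fmapO (μ₀ pair) x) K'
    i = backI (μ₀ pair) (outer s₁)
    L = castIdx (val-back (μ₀ pair) (outer s₁)) (inner s₁)
    s₂ = μsplit (val i) L
    j = outer s₂
    k = inner s₂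

    key-split₃ : key K' ≡ pair (key i) (pair (key j) (key k))
    key-split₃ = trans (key-split s₁)
      (cong (pair _) (trans (sym (key-castIdx (val-back (μ₀ pair) (outer s₁)) (inner s₁))) (key-split s₂)))

  module _ (A : RawGroupoid) where
    private
      X = Obj A

    α-π : (x : FamObj X) → Idx x → Idx (μ₀ pair (η₀ x))
    α-π x j = μIdx {x = η₀ x} (0 , here) j

    α-π⁻ : (x : FamObj X) → Idx (μ₀ pair (η₀ x)) → Idx x
    α-π⁻ x K = castIdx (cong val (η₀-Idx (outer s))) (inner s)
      where s = μsplit (η₀ x) K

    opaque
      α-at : (x : FamObj X) → FamHom A x (μ₀ pair (η₀ x))
      α-at x = reindexing A x (μ₀ pair (η₀ x)) (α-π x) (α-π⁻ x) α-π⁻∘π α-π∘π⁻ (val-μIdx {x = η₀ x} (0 , here))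
        where
        α-π⁻∘π : ∀ j → key (α-π⁻ x (α-π x j)) ≡ key j
        α-π⁻∘π j = let s = μsplit (η₀ x) (α-π x j) in
          trans (key-castIdx (cong val (η₀-Idx (outer s))) (inner s))
                (proj₂ (split-keys (η₀ x) (α-π x j) (key-μIdx _ _)))
        α-π∘π⁻ : ∀ K → key (α-π x (α-π⁻ x K)) ≡ key K
        α-π∘π⁻ K = let s = μsplit (η₀ x) K in
          trans (key-μIdx _ _)
                (trans (cong₂ pair (sym (cong key (η₀-Idx (outer s))))
                                   (key-castIdx (cong val (η₀-Idx (outer s))) (inner s)))
                       (sym (key-split s)))

    β-π : (x : FamObj X) → Idx x → Idx (μ₀ pair (fmapO η₀ x))
    β-π x j = μIdx (convI η₀ j) (castIdx (sym (val-conv η₀ j)) (0 , here))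

    β-π⁻ : (x : FamObj X) → Idx (μ₀ pair (fmapO η₀ x)) → Idx x
    β-π⁻ x K = backI η₀ (outer (μsplit (fmapO η₀ x) K))

    opaque
      β-at : (x : FamObj X) → FamHom A x (μ₀ pair (fmapO η₀ x))
      β-at x = reindexing A x (μ₀ pair (fmapO η₀ x)) (β-π x) (β-π⁻ x) β-π⁻∘π β-π∘π⁻ val-β-π
        where
        β-π⁻∘π : ∀ j → key (β-π⁻ x (β-π x j)) ≡ key j
        β-π⁻∘π j = proj₁ (split-keys (fmapO η₀ x) (β-π x j) (key-μIdx _ _))
        β-π∘π⁻ : ∀ K → key (β-π x (β-π⁻ x K)) ≡ key K
        β-π∘π⁻ K = let s = μsplit (fmapO η₀ x) K in
          trans (key-μIdx _ _)
                (trans (cong (pair _)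
                         (trans (key-castIdx (sym (val-conv η₀ (backI η₀ (outer s)))) (0 , here))
                                (sym (key-η₀ (val-back η₀ (outer s)) (inner s)))))
                       (sym (key-split s)))
        val-β-π : ∀ j → val (β-π x j) ≡ val j
        val-β-π j = trans (val-μIdx _ _) (val-castIdx (sym (val-conv η₀ j)) (0 , here))

    module _ (x : FamObj (FamObj (FamObj X))) where

      γ-π : Idx (μ₀ pair (μ₀ pair x)) → Idx (μ₀ pair (fmapO (μ₀ pair) x))
      γ-π K = μIdx (convI (μ₀ pair) i) (castIdx (sym (val-conv (μ₀ pair) i)) (μIdx j k))
        where open Split₃ x K

      key-γ-π : ∀ K {a b c} → key K ≡ pair (pair a b) c → key (γ-π K) ≡ pair a (pair b c)
      key-γ-π K e =
        trans (key-μIdx _ _) (cong₂ pair (proj₁ outer-keys)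
          (trans (key-castIdx (sym (val-conv (μ₀ pair) i)) (μIdx j k))
          (trans (key-μIdx _ _) (cong₂ pair (proj₂ outer-keys) (trans key-k (proj₂ keys))))))
        where
        open Split₃ x K
        keys = split-keys (μ₀ pair x) K e
        outer-keys = split-keys x (outer s₁) (proj₁ keys)

      val-γ-π : ∀ K → val (γ-π K) ≡ val K
      val-γ-π K =
        trans (val-μIdx _ _)
        (trans (val-castIdx (sym (val-conv (μ₀ pair) i)) (μIdx j k))
        (trans (val-μIdx j k)
        (trans (val-castIdx (sym (val-split s₂)) (inner s₁)) (val-split s₁))))
        where open Split₃ x K

      γ-π⁻ : Idx (μ₀ pair (fmapO (μ₀ pair) x)) → Idx (μ₀ pair (μ₀ pair x))
      γ-π⁻ K' = μIdx (μIdx i j) (castIdx (sym (val-μIdx i j)) k)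
        where open Split₃' x K'

      key-γ-π⁻ : ∀ K' {a b c} → key K' ≡ pair a (pair b c) → key (γ-π⁻ K') ≡ pair (pair a b) c
      key-γ-π⁻ K' e =
        trans (key-μIdx _ _)
          (cong₂ pair (trans (key-μIdx _ _) (cong₂ pair (proj₁ keys) (proj₁ inner-keys)))
                      (trans (key-castIdx (sym (val-μIdx i j)) k) (proj₂ inner-keys)))
        where
        open Split₃' x K'
        keys = split-keys (fmapO (μ₀ pair) x) K' e
        inner-keys = split-keys (val i) L
          (trans (key-castIdx (val-back (μ₀ pair) (outer s₁)) (inner s₁)) (proj₂ keys))

      opaque
        γ-at : FamHom A (μ₀ pair (μ₀ pair x)) (μ₀ pair (fmapO (μ₀ pair) x))
        γ-at = reindexing A _ _ γ-π γ-π⁻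
          (λ K → let open Split₃ x K in
                 trans (key-γ-π⁻ (γ-π K) (key-γ-π K key-split₃)) (sym key-split₃))
          (λ K' → let open Split₃' x K' in
                  trans (key-γ-π (γ-π⁻ K') (key-γ-π⁻ K' key-split₃)) (sym key-split₃))
          val-γ-π

      opaque
        unfolding γ-at
        γ-key : ∀ K {a b c} → key K ≡ pair (pair a b) c → key (π γ-at K) ≡ pair a (pair b c)
        γ-key K e = trans (cong key (π-reindexing A _ _ γ-π _ _ _ _ K)) (key-γ-π K e)

        γ-id : IsGroupoid A → ∀ K → HEq A (comp γ-at K) (id A {val K})
        γ-id isA K = comp-reindexing A isA _ _ γ-π _ _ _ _ K

    opaque
      unfolding α-at β-at
      α-key : ∀ x (j : Idx x) → key (π (α-at x) j) ≡ pair 0 (key j)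
      α-key x j = trans (cong key (π-reindexing A _ _ (α-π x) _ _ _ _ j)) (key-μIdx {x = η₀ x} (0 , here) j)

      β-key : ∀ x (j : Idx x) → key (π (β-at x) j) ≡ pair (key j) 0
      β-key x j = trans (cong key (π-reindexing A _ _ (β-π x) _ _ _ _ j))
                    (trans (key-μIdx _ _) (cong (pair (key j)) (key-castIdx (sym (val-conv η₀ j)) (0 , here))))

      α-id : IsGroupoid A → ∀ x (j : Idx x) → HEq A (comp (α-at x) j) (id A {val j})
      α-id isA x j = comp-reindexing A isA _ _ (α-π x) _ _ _ _ j

      β-id : IsGroupoid A → ∀ x (j : Idx x) → HEq A (comp (β-at x) j) (id A {val j})
      β-id isA x j = comp-reindexing A isA _ _ (β-π x) _ _ _ _ j

  module _ (A : Groupoid) where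
    private
      isA = Groupoid.isGroupoid A
      module A = FamGroupoid ∣ A ∣ isA

    α-spec : ∀ x (j : Idx x) →
             key (π (α-at ∣ A ∣ x) j) ≡ pair 0 (key j) × HEq ∣ A ∣ (comp (α-at ∣ A ∣ x) j) (id ∣ A ∣ {val j})
    α-spec x j = α-key (∣ A ∣) x j , α-id (∣ A ∣) isA x j

    β-spec : ∀ x (j : Idx x) →
             key (π (β-at ∣ A ∣ x) j) ≡ pair (key j) 0 × HEq ∣ A ∣ (comp (β-at ∣ A ∣ x) j) (id ∣ A ∣ {val j})
    β-spec x j = β-key (∣ A ∣) x j , β-id (∣ A ∣) isA x j

    α-natural : IsNatural (idR (T ∣ A ∣)) (μR A ∘R ηR (T ∣ A ∣)) (α-at ∣ A ∣)
    α-natural {x} {y} f =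
      A.pointwise⇒≈ {φ = famComp ∣ A ∣ (α-at ∣ A ∣ y) f}
                    {ψ = famComp ∣ A ∣ (μ₁ (F₁ (ηR (T ∣ A ∣)) f)) (α-at ∣ A ∣ x)} λ i →
        let μηf = μ₁-spec ∣ A ∣ isA (F₁ (ηR (T ∣ A ∣)) f) (π (α-at ∣ A ∣ x) i) (0 , here) i (α-key ∣ A ∣ x i)
        in trans (α-key ∣ A ∣ y (π f i)) (sym (proj₁ μηf)) ,
           A.≋-trans (A.identityˡ-≋ (α-id ∣ A ∣ isA y (π f i)))
                     (A.≋-sym (A.≋-trans (A.identityʳ-≋ (α-id ∣ A ∣ isA x i)) (proj₂ μηf)))

    β-natural : IsNatural (idR (T ∣ A ∣)) (μR A ∘R TF (ηR ∣ A ∣)) (β-at ∣ A ∣)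
    β-natural {x} {y} f =
      A.pointwise⇒≈ {φ = famComp ∣ A ∣ (β-at ∣ A ∣ y) f}
                    {ψ = famComp ∣ A ∣ (μ₁ (F₁ (TF (ηR ∣ A ∣)) f)) (β-at ∣ A ∣ x)} λ i →
        let j = castIdx (sym (val-conv η₀ i)) (0 , here)
            key-j = key-castIdx (sym (val-conv η₀ i)) (0 , here)
            μ!ηf = μ₁-spec ∣ A ∣ isA (F₁ (TF (ηR ∣ A ∣)) f) (π (β-at ∣ A ∣ x) i) (convI η₀ i) j
                     (trans (β-key ∣ A ∣ x i) (cong (pair (key i)) (sym key-j)))
            !ηf = TF₁-spec (T-isGroupoid A) (ηR ∣ A ∣) f (convI η₀ i) i refl
            !ηf-inner = A.≋⇒agreeOnKeys (proj₂ !ηf) j (0 , here) key-j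
        in trans (β-key ∣ A ∣ y (π f i)) (sym (trans (proj₁ μ!ηf) (cong₂ pair (proj₁ !ηf) (proj₁ !ηf-inner)))) ,
           A.≋-trans (A.identityˡ-≋ (β-id ∣ A ∣ isA y (π f i)))
                     (A.≋-sym (A.≋-trans (A.identityʳ-≋ (β-id ∣ A ∣ isA x i)) (A.≋-trans (proj₂ μ!ηf) (proj₂ !ηf-inner))))

  module _ {A B : Groupoid} (F : Functor A B) where
    private
      isA = Groupoid.isGroupoid A
      isB = Groupoid.isGroupoid B
      module B = FamGroupoid ∣ B ∣ isB
      F₀F = F₀ ⌊ F ⌋

      F-id-≋ : ∀ {a b a'} {f : Hom ∣ A ∣ a b} →
               HEq ∣ A ∣ f (id ∣ A ∣ {a'}) → HEq ∣ B ∣ (F₁ ⌊ F ⌋ f) (id ∣ B ∣ {F₀F a'})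
      F-id-≋ p = B.≋-trans (F₁-resp-≋ ⌊ F ⌋ (Functor.isFunctor F) p) (B.≈⇒≋ (IsFunctor.F-id (Functor.isFunctor F)))

    α-modification : ∀ x → HEq (T ∣ B ∣) (α-at ∣ B ∣ (F₀ (TF ⌊ F ⌋) x)) (F₁ (TF ⌊ F ⌋) (α-at ∣ A ∣ x))
    α-modification x = B.agreeOnKeys⇒≋ refl (μ₀-fmapO pair F₀F (η₀ x)) λ i i' e →
      let i₀ = backI F₀F i'
          !Fα = TF₁-spec isB ⌊ F ⌋ (α-at ∣ A ∣ x) i' i₀ refl
      in trans (α-key ∣ B ∣ (fmapO F₀F x) i) (trans (cong (pair 0) e) (sym (trans (proj₁ !Fα) (α-key ∣ A ∣ x i₀)))) ,
         B.≋-id-unique (α-id ∣ B ∣ isB (fmapO F₀F x) i) (B.≋-trans (proj₂ !Fα) (F-id-≋ (α-id ∣ A ∣ isA x i₀)))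
                       (trans (cong val (key-injective {i = i} {i'} e)) (val-back F₀F i'))

    β-modification : ∀ x → HEq (T ∣ B ∣) (β-at ∣ B ∣ (F₀ (TF ⌊ F ⌋) x)) (F₁ (TF ⌊ F ⌋) (β-at ∣ A ∣ x))
    β-modification x = B.agreeOnKeys⇒≋ refl tgt≡ λ i i' e →
      let i₀ = backI F₀F i'
          !Fβ = TF₁-spec isB ⌊ F ⌋ (β-at ∣ A ∣ x) i' i₀ refl
      in trans (β-key ∣ B ∣ (fmapO F₀F x) i) (trans (cong (λ k → pair k 0) e) (sym (trans (proj₁ !Fβ) (β-key ∣ A ∣ x i₀)))) ,
         B.≋-id-unique (β-id ∣ B ∣ isB (fmapO F₀F x) i) (B.≋-trans (proj₂ !Fβ) (F-id-≋ (β-id ∣ A ∣ isA x i₀)))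
                       (trans (cong val (key-injective {i = i} {i'} e)) (val-back F₀F i'))
      where
      tgt≡ : μ₀ pair (fmapO η₀ (fmapO F₀F x)) ≡ fmapO F₀F (μ₀ pair (fmapO η₀ x))
      tgt≡ = trans (cong (μ₀ pair) (trans (fmapO-∘ η₀ F₀F x) (sym (fmapO-∘ (fmapO F₀F) η₀ x))))
                   (μ₀-fmapO pair F₀F (fmapO η₀ x))

    γ-modification : ∀ x → HEq (T ∣ B ∣) (γ-at ∣ B ∣ (F₀ (TF (TF (TF ⌊ F ⌋))) x)) (F₁ (TF ⌊ F ⌋) (γ-at ∣ A ∣ x))
    γ-modification x = B.agreeOnKeys⇒≋ src≡ tgt≡ λ K K' e →
      let K₀ = backI F₀F K'
          key-K = Split₃.key-split₃ x!!! K
          !Fγ = TF₁-spec isB ⌊ F ⌋ (γ-at ∣ A ∣ x) K' K₀ refl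
      in trans (γ-key ∣ B ∣ x!!! K key-K) (sym (trans (proj₁ !Fγ) (γ-key ∣ A ∣ x K₀ (trans (sym e) key-K)))) ,
         B.≋-id-unique (γ-id ∣ B ∣ x!!! isB K) (B.≋-trans (proj₂ !Fγ) (F-id-≋ (γ-id ∣ A ∣ x isA K₀)))
                       (trans (val-cong-key src≡ K K' e) (val-back F₀F K'))
      where
      x!!! = F₀ (TF (TF (TF ⌊ F ⌋))) x
      src≡ : μ₀ pair (μ₀ pair x!!!) ≡ fmapO F₀F (μ₀ pair (μ₀ pair x))
      src≡ = trans (cong (μ₀ pair) (μ₀-fmapO pair (fmapO F₀F) x)) (μ₀-fmapO pair F₀F (μ₀ pair x))
      tgt≡ : μ₀ pair (fmapO (μ₀ pair) x!!!) ≡ fmapO F₀F (μ₀ pair (fmapO (μ₀ pair) x))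
      tgt≡ = trans (cong (μ₀ pair) (trans (fmapO-∘ (μ₀ pair) (fmapO (fmapO F₀F)) x)
                                   (trans (fmapO-cong (μ₀-fmapO pair F₀F) x) (sym (fmapO-∘ (fmapO F₀F) (μ₀ pair) x)))))
                   (μ₀-fmapO pair F₀F (fmapO (μ₀ pair) x))

  module _ (A : Groupoid) where
    private
      isA = Groupoid.isGroupoid A
      module A = FamGroupoid ∣ A ∣ isA

    γ-spec : ∀ x (i : Idx x) (j : Idx (val i)) (k : Idx (val j))
             (m : pair (pair (key i) (key j)) (key k) ∈ₖ μ₀ pair (μ₀ pair x)) →
             key (π (γ-at ∣ A ∣ x) (_ , m)) ≡ pair (key i) (pair (key j) (key k))
             × HEq ∣ A ∣ (comp (γ-at ∣ A ∣ x) (_ , m)) (id ∣ A ∣ {val k})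
    γ-spec x i j k m =
      γ-key ∣ A ∣ x (_ , m) refl ,
      A.≋-trans (γ-id ∣ A ∣ x isA (_ , m))
        (A.id-≋ (trans (val-μ (_ , m) (μIdx i j) k' (cong₂ pair (sym (key-μIdx i j)) (sym (key-castIdx (sym (val-μIdx i j)) k))))
                       (val-castIdx (sym (val-μIdx i j)) k)))
      where k' = castIdx (sym (val-μIdx i j)) k

    module γ-Naturality {x y} (f : FamHom (T (T ∣ A ∣)) x y) (K : Idx (μ₀ pair (μ₀ pair x))) where
      open Split₃ x K
      private
        μf = μ₁ f
        μμf = μ₁ μf
        !μf = F₁ (TF (μR A)) f
        I = outer s₁
        i! = convI (μ₀ pair) i
        jk = castIdx (sym (val-conv (μ₀ pair) i)) (μIdx j k)

        μμf-at = μ₁-spec ∣ A ∣ isA μf K I (inner s₁) (key-split s₁)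
        μf-at = μ₁-spec (T ∣ A ∣) (T-isGroupoid A) f I i j (key-split s₂)
        μf-inner = A.≋⇒agreeOnKeys (proj₂ μf-at) (inner s₁) k (sym key-k)
        μ!μf-at = μ₁-spec ∣ A ∣ isA !μf (π (γ-at ∣ A ∣ x) K) i! jk
                    (trans (γ-key ∣ A ∣ x K key-split₃)
                           (cong (pair (key i)) (sym (trans (key-castIdx (sym (val-conv (μ₀ pair) i)) (μIdx j k))
                                                            (key-μIdx j k)))))
        !μf-at = TF₁-spec (T-isGroupoid A) (μR A) f i! i refl
        !μf-inner = A.≋⇒agreeOnKeys (proj₂ !μf-at) jk (μIdx j k) (key-castIdx (sym (val-conv (μ₀ pair) i)) (μIdx j k))
        μfi-at = μ₁-spec ∣ A ∣ isA (comp f i) (μIdx j k) j k (key-μIdx j k)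

      keys-agree : key (π (γ-at ∣ A ∣ y) (π μμf K)) ≡ key (π (μ₁ !μf) (π (γ-at ∣ A ∣ x) K))
      keys-agree =
        trans (γ-key ∣ A ∣ y (π μμf K) (trans (proj₁ μμf-at) (cong₂ pair (proj₁ μf-at) (proj₁ μf-inner))))
              (sym (trans (proj₁ μ!μf-at) (cong₂ pair (proj₁ !μf-at) (trans (proj₁ !μf-inner) (proj₁ μfi-at)))))

      comps-agree : HEq ∣ A ∣ (_∘_ ∣ A ∣ (comp (γ-at ∣ A ∣ y) (π μμf K)) (comp μμf K))
                              (_∘_ ∣ A ∣ (comp (μ₁ !μf) (π (γ-at ∣ A ∣ x) K)) (comp (γ-at ∣ A ∣ x) K))
      comps-agree =
        A.≋-trans (A.identityˡ-≋ (γ-id ∣ A ∣ y isA (π μμf K)))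
          (A.≋-trans (proj₂ μμf-at) (A.≋-trans (proj₂ μf-inner)
            (A.≋-sym (A.≋-trans (A.identityʳ-≋ (γ-id ∣ A ∣ x isA K))
                                (A.≋-trans (proj₂ μ!μf-at) (A.≋-trans (proj₂ !μf-inner) (proj₂ μfi-at)))))))

    γ-natural : IsNatural (μR A ∘R μR (TG T-isGroupoid A)) (μR A ∘R TF (μR A)) (γ-at ∣ A ∣)
    γ-natural {x} {y} f =
      A.pointwise⇒≈ {φ = famComp ∣ A ∣ (γ-at ∣ A ∣ y) (μ₁ (μ₁ f))}
                    {ψ = famComp ∣ A ∣ (μ₁ (F₁ (TF (μR A)) f)) (γ-at ∣ A ∣ x)}
        λ K → γ-Naturality.keys-agree f K , γ-Naturality.comps-agree f K

  -- The coherence axioms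

  module _ (A : Groupoid) where
    private
      isA = Groupoid.isGroupoid A
      module A = FamGroupoid ∣ A ∣ isA
      TA = T ∣ A ∣

    module Triangle (x : FamObj (FamObj (Obj ∣ A ∣))) where
      lhs : FamHom ∣ A ∣ (μ₀ pair x) (μ₀ pair (fmapO (μ₀ pair) (fmapO η₀ x)))
      lhs = _∘_ TA (γ-at ∣ A ∣ (F₀ (TF (ηR TA)) x)) (μ₁ (β-at TA x))

      rhs : FamHom ∣ A ∣ (μ₀ pair (fmapO (λ a → a) x)) (μ₀ pair (fmapO (λ a → μ₀ pair (η₀ a)) x))
      rhs = μ₁ (T2 (idR TA) (μR A ∘R ηR TA) (α-at ∣ A ∣) x)

      module At (K : Idx (μ₀ pair x)) (K' : Idx (μ₀ pair (fmapO (λ a → a) x))) (e : key K ≡ key K') where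
        private
          s = μsplit x K
          i = outer s
          j = inner s
          i! = convI (λ a → a) i
          j! = castIdx (sym (val-conv (λ a → a) i)) j
          key-j! = key-castIdx (sym (val-conv (λ a → a) i)) j

          μβ-at = μ₁-spec ∣ A ∣ isA (β-at TA x) K i j (key-split s)
          β-inner = A.≋⇒agreeOnKeys (β-id TA (T-isGroupoid A) x i) j j refl
          μα-at = μ₁-spec ∣ A ∣ isA (T2 (idR TA) (μR A ∘R ηR TA) (α-at ∣ A ∣) x) K' i! j!
                    (trans (sym e) (trans (key-split s) (cong (pair (key i)) (sym key-j!))))
          !α-at = T2-spec (T-isGroupoid A) (idR TA) (μR A ∘R ηR TA) (α-at ∣ A ∣) x i! i refl
          α-inner = A.≋⇒agreeOnKeys (proj₂ !α-at) j! j key-j!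

        keys-agree : key (π lhs K) ≡ key (π rhs K')
        keys-agree =
          trans (γ-key ∣ A ∣ (F₀ (TF (ηR TA)) x) (π (μ₁ (β-at TA x)) K)
                  (trans (proj₁ μβ-at) (cong₂ pair (β-key TA x i) (proj₁ β-inner))))
                (sym (trans (proj₁ μα-at) (cong₂ pair (proj₁ !α-at) (trans (proj₁ α-inner) (α-key ∣ A ∣ (val i) j)))))

        comps-agree : HEq ∣ A ∣ (comp lhs K) (comp rhs K')
        comps-agree =
          A.≋-id-unique
            (A.≋-trans (A.identityˡ-≋ (γ-id ∣ A ∣ (F₀ (TF (ηR TA)) x) isA (π (μ₁ (β-at TA x)) K)))
                       (A.≋-trans (proj₂ μβ-at) (proj₂ β-inner)))
            (A.≋-trans (proj₂ μα-at) (A.≋-trans (proj₂ α-inner) (α-id ∣ A ∣ isA (val i) j)))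
            refl

    triangle : ∀ x → HEq TA (Triangle.lhs x) (Triangle.rhs x)
    triangle x =
      A.agreeOnKeys⇒≋ {φ = Triangle.lhs x} {ψ = Triangle.rhs x}
        (cong (μ₀ pair) (sym (fmapO-id x))) (cong (μ₀ pair) (fmapO-∘ (μ₀ pair) η₀ x))
        λ K K' e → Triangle.At.keys-agree x K K' e , Triangle.At.comps-agree x K K' e

    module Pentagon (x : FamObj (FamObj (FamObj (FamObj (Obj ∣ A ∣))))) where
      private
        μμ = μR A ∘R μR (TG T-isGroupoid A)
        μ!μ = μR A ∘R TF (μR A)

      e₁ : μ₀ pair (F₀ (TF (μR A)) (μ₀ pair x)) ≡ μ₀ pair (μ₀ pair (F₀ (TF (TF (μR A))) x))
      e₁ = cong (μ₀ pair) (sym (μ₀-fmapO pair (μ₀ pair) x))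

      e₂ : μ₀ pair (F₀ (TF (μR A)) (F₀ (TF (μR (TG T-isGroupoid A))) x)) ≡ μ₀ pair (F₀ (TF μμ) x)
      e₂ = cong (μ₀ pair) (fmapO-∘ (μ₀ pair) (μ₀ pair) x)

      γ₁ = γ-at ∣ A ∣ (μ₀ pair x)
      γ₂ = γ-at ∣ A ∣ (F₀ (TF (TF (μR A))) x)
      γ₃ = γ-at ∣ A ∣ (F₀ (TF (μR (TG T-isGroupoid A))) x)
      μγ = μ₁ (γ-at TA x)
      μ!γ = μ₁ (T2 μμ μ!μ (γ-at ∣ A ∣) x)

      lhs : FamHom ∣ A ∣ (μ₀ pair (μ₀ pair (μ₀ pair x))) (μ₀ pair (F₀ (TF (μR A)) (F₀ (TF (TF (μR A))) x)))
      lhs = compAlong TA γ₂ e₁ γ₁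

      rhs : FamHom ∣ A ∣ (μ₀ pair (μ₀ pair (μ₀ pair x))) (μ₀ pair (F₀ (TF μ!μ) x))
      rhs = compAlong TA μ!γ e₂ (_∘_ TA γ₃ μγ)

      -- K = ⟨⟨⟨a,b⟩,c⟩,d⟩ ; both sides send it to ⟨a,⟨b,⟨c,d⟩⟩⟩
      module At (K : Idx (μ₀ pair (μ₀ pair (μ₀ pair x)))) where
        private
          module Outer = Split₃ (μ₀ pair x) K
          module Inner = Split₃ x (outer Outer.s₁)
          P = outer Outer.s₁
          d = inner Outer.s₁
          a = Inner.i
          b = Inner.j
          c = inner Inner.s₁
          c' = Inner.k
          d' = castIdx (sym (val-castIdx (sym (val-split Inner.s₂)) c)) Outer.k

          key-P = Inner.key-split₃
          γ₁-at = γ-key ∣ A ∣ (μ₀ pair x) K Outer.key-split₃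
          γ₁-moved = A.subst-agreeOnKeys e₁ γ₁ K K refl
          γ₂-at = γ-key ∣ A ∣ (F₀ (TF (TF (μR A))) x) (π (subst (FamHom ∣ A ∣ _) e₁ γ₁) K)
                    (trans (proj₁ γ₁-moved) (trans γ₁-at (cong₂ (λ z w → pair z (pair w (key Outer.k)))
                                                                  (key-split Inner.s₂) (sym Inner.key-k))))

          μγ-at = μ₁-spec ∣ A ∣ isA (γ-at TA x) K P d (key-split Outer.s₁)
          γ-inner = A.≋⇒agreeOnKeys (γ-id TA x (T-isGroupoid A) P) d d refl
          γ₃-at = γ-key ∣ A ∣ (F₀ (TF (μR (TG T-isGroupoid A))) x) (π μγ K)
                    (trans (proj₁ μγ-at) (cong₂ pair (γ-key TA x P key-P) (proj₁ γ-inner)))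
          γ₃μγ-moved = A.subst-agreeOnKeys e₂ (_∘_ TA γ₃ μγ) K K refl

          a! = convI (F₀ μμ) a
          L₀ = μIdx (μIdx b c') (castIdx (sym (val-μIdx b c')) d')
          L = castIdx (sym (val-conv (F₀ μμ) a)) L₀
          key-L₀ : key L₀ ≡ pair (pair (key b) (key c')) (key d)
          key-L₀ = trans (key-μIdx _ _) (cong₂ pair (key-μIdx b c')
                     (trans (key-castIdx (sym (val-μIdx b c')) d')
                     (trans (key-castIdx (sym (val-castIdx (sym (val-split Inner.s₂)) c)) Outer.k) Outer.key-k)))
          μ!γ-at = μ₁-spec ∣ A ∣ isA (T2 μμ μ!μ (γ-at ∣ A ∣) x) (π (subst (FamHom ∣ A ∣ _) e₂ (_∘_ TA γ₃ μγ)) K) a! L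
                     (trans (proj₁ γ₃μγ-moved)
                       (trans γ₃-at (cong (pair (key a)) (sym (trans (key-castIdx (sym (val-conv (F₀ μμ) a)) L₀) key-L₀)))))
          !γ-at = T2-spec (T-isGroupoid A) μμ μ!μ (γ-at ∣ A ∣) x a! a refl
          !γ-inner = A.≋⇒agreeOnKeys (proj₂ !γ-at) L L₀ (key-castIdx (sym (val-conv (F₀ μμ) a)) L₀)

        keys-agree : key (π lhs K) ≡ key (π rhs K)
        keys-agree =
          trans γ₂-at (trans (cong (λ z → pair (key a) (pair (key b) (pair (key c') z))) Outer.key-k)
            (sym (trans (proj₁ μ!γ-at)
                        (cong₂ pair (proj₁ !γ-at) (trans (proj₁ !γ-inner) (γ-key ∣ A ∣ (val a) L₀ key-L₀))))))

        comps-agree : HEq ∣ A ∣ (comp lhs K) (comp rhs K)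
        comps-agree =
          A.≋-id-unique
            (A.≋-trans (A.identityˡ-≋ (γ-id ∣ A ∣ (F₀ (TF (TF (μR A))) x) isA _))
                       (A.≋-trans (proj₂ γ₁-moved) (γ-id ∣ A ∣ (μ₀ pair x) isA K)))
            (A.≋-trans (A.identityˡ-≋ (A.≋-trans (proj₂ μ!γ-at) (A.≋-trans (proj₂ !γ-inner) (γ-id ∣ A ∣ (val a) isA L₀))))
              (A.≋-trans (proj₂ γ₃μγ-moved)
                (A.≋-trans (A.identityˡ-≋ (γ-id ∣ A ∣ (F₀ (TF (μR (TG T-isGroupoid A))) x) isA (π μγ K)))
                           (A.≋-trans (proj₂ μγ-at) (proj₂ γ-inner)))))
            (sym (val-split Outer.s₁))

    pentagon : ∀ x → HEq TA (Pentagon.lhs x) (Pentagon.rhs x)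
    pentagon x =
      A.agreeOnKeys⇒≋ {φ = Pentagon.lhs x} {ψ = Pentagon.rhs x} refl (cong (μ₀ pair) (fmapO-∘ (μ₀ pair) (F₀ (TF (μR A))) x))
        (A.pointwise⇒agreeOnKeys {φ = Pentagon.lhs x} {ψ = Pentagon.rhs x}
          λ K → Pentagon.At.keys-agree x K , Pentagon.At.comps-agree x K)

proposition4 : (pair : ℕ → ℕ → ℕ) →
               (∀ {i j i' j'} → pair i j ≡ pair i' j' → i ≡ i' × j ≡ j') →
               Σ[ fg ∈ ((A : Groupoid) → IsGroupoid (T ∣ A ∣)) ] IsPseudomonad pair fg
proposition4 pair pair-injective = T-isGroupoid , record
  { T-functor = TF-isFunctor
  ; T-id = TF-id
  ; T-comp = TF-∘
  ; T2-natural = T2-natural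
  ; T2-id = T2-id
  ; T2-vcomp = T2-vcomp
  ; T2-whiskerL = T2-whiskerL
  ; T2-whiskerR = T2-whiskerR
  ; η-functor = ηR-isFunctor
  ; η-nat₁ = ηR-natural
  ; η-nat₂ = ηR-2natural
  ; μ₁ = λ A → μ₁
  ; μ-spec = μ-spec
  ; μ-functor = μ-isFunctor
  ; μ-nat₁ = μ-natural
  ; μ-nat₂ = μ-2natural
  ; α = λ A → α-at ∣ A ∣
  ; α-spec = α-spec
  ; α-natural = α-natural
  ; α-modification = α-modification
  ; β = λ A → β-at ∣ A ∣
  ; β-spec = β-spec
  ; β-natural = β-natural
  ; β-modification = β-modification
  ; γ = λ A → γ-at ∣ A ∣
  ; γ-spec = γ-spec
  ; γ-natural = γ-natural
  ; γ-modification = γ-modification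
  ; pentagon = λ A x → Pentagon.e₁ A x , Pentagon.e₂ A x , pentagon A x
  ; triangle = triangle
  }
  where open Multiplication pair pair-injective
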